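{- For $n\ge1$ and $k\ge0$ let $d_{n,k}$ be the number of $f\in F_n^{\nearrow}$ such that $f$ has no fixed point greater than $1$ (i.e. $f_i\ne i$ for all $2\le i\le n$), $f$ has exactly $k$ plateaus of height $1$ (i.e. exactly $k$ indices $i\in[n-1]$ with $f_i=f_{i+1}=1$), and $\phi(f)$ avoids the pattern $132$. Then $d_{1,1}=0$ and, for $n\ge2$ and $1\le k\le n-1$, $$d_{n,k}=d_{n-1,k-1}+d_{n-k,k}.$$
   Context: $[n]=\{1,\dots,n\}$, $\mathfrak{S}_n$ the symmetric group on $[n]$; products of permutations are composed with the leftmost factor acting first: $(\alpha\beta)(x)=\beta(\alpha(x))$. A function $f:[n]\to[n]$ is subexceedant if $1\le f(i)\le i$ for all $i$, written $f_1\cdots f_n$; $F_n^{\nearrow}$ is the set of non-decreasing ($f_1\le\cdots\le f_n$) subexceedant functions on $[n]$. $\phi(f)=(1,f_1)(2,f_2)\cdots(n,f_n)\in\mathfrak{S}_n$ (with $(i,i)$ the identity). A permutation $\sigma$ contains the pattern $132$ if there are $a<b<c$ with $\sigma(a)<\sigma(c)<\sigma(b)$, and avoids it otherwise. -}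

module Defs where

open import Data.Nat using (ℕ; zero; suc; _+_; _∸_; _≡ᵇ_; _<ᵇ_; _≤ᵇ_)
open import Data.Bool using (Bool; true; false; if_then_else_; _∧_; not)
open import Data.List using (List; []; _∷_; _++_; [_]; map; concatMap; foldl; length; filterᵇ)
open import Data.Bool.ListAction using (all; any)

-- Conventions: everything is 1-indexed as in the paper.
-- A function f : [n] → [n] is encoded as the list f₁ ⋯ fₙ of natural numbers.

interval : ℕ → ℕ → List ℕ
interval a b = go a (suc b ∸ a)
  where
  go : ℕ → ℕ → List ℕ
  go x zero = []
  go x (suc m) = x ∷ go (suc x) m

upto : ℕ → List ℕ
upto n = interval 1 n

-- 1-indexed lookup: at f i = fᵢ (0 if out of range)
at : List ℕ → ℕ → ℕ
at [] _ = 0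
at (x ∷ xs) zero = 0
at (x ∷ xs) (suc zero) = x
at (x ∷ xs) (suc (suc i)) = at xs (suc i)

subexceedant : ℕ → List (List ℕ)
subexceedant zero = [] ∷ []
subexceedant (suc n) =
  concatMap (λ f → map (λ v → f ++ [ v ]) (upto (suc n))) (subexceedant n)

nondecreasing : ℕ → List ℕ → Bool
nondecreasing n f = all (λ i → at f i ≤ᵇ at f (suc i)) (upto (n ∸ 1))

noFixedPointAbove1 : ℕ → List ℕ → Bool
noFixedPointAbove1 n f = all (λ i → not (at f i ≡ᵇ i)) (interval 2 n)

plateaus1 : ℕ → List ℕ → ℕ
plateaus1 n f =
  length (filterᵇ (λ i → (at f i ≡ᵇ 1) ∧ (at f (suc i) ≡ᵇ 1)) (upto (n ∸ 1)))

transp : ℕ → ℕ → ℕ → ℕ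
transp a b x = if x ≡ᵇ a then b else (if x ≡ᵇ b then a else x)

-- φ(f) = (1,f₁)(2,f₂)⋯(n,fₙ), leftmost factor acting first:
-- φ(f)(x) = (n,fₙ)( ⋯ (2,f₂)((1,f₁)(x)) ⋯ )
φ : List ℕ → ℕ → ℕ
φ f x = go 1 f x
  where
  go : ℕ → List ℕ → ℕ → ℕ
  go i [] x = x
  go i (v ∷ vs) x = go (suc i) vs (transp i v x)

contains132 : ℕ → (ℕ → ℕ) → Bool
contains132 n σ =
  any (λ a → any (λ b → any (λ c →
        (a <ᵇ b) ∧ (b <ᵇ c) ∧ (σ a <ᵇ σ c) ∧ (σ c <ᵇ σ b))
      (upto n)) (upto n)) (upto n)

avoids132 : ℕ → (ℕ → ℕ) → Bool
avoids132 n σ = not (contains132 n σ)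

d : ℕ → ℕ → ℕ
d n k = length (filterᵇ
  (λ f → nondecreasing n f ∧ noFixedPointAbove1 n f ∧ (plateaus1 n f ≡ᵇ k)
         ∧ avoids132 n (φ f))
  (subexceedant n))

{-# OPTIONS --safe #-}
-- A good word f (non-decreasing, subexceedant, f₁ = f₂ = 1, no fixed point
-- above 1, φ(f) avoiding 132) of length n ≥ 2 has a rigid shape: with a = fₙ
-- and b = φ(f)(1), φ(f) reads b (b+1) ⋯ n (a+1) ⋯ (b−1) followed by the values
-- 1, …, a. Appending a letter a ≤ v ≤ n keeps the word good exactly when
-- v ∈ {a + 1, b}, or v = a = 1; any other v creates a 132 pattern whose
-- smallest entry is below the last letter, and such a pattern survives every
-- further non-decreasing extension. Hence good words are counted by a
-- transfer operator on the triples (last letter, φ(f)(1), number of plateaus).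
-- Iterating it from the word 11 gives d(n, k) = [k = n − 1] plus, for k ≤ n − 2,
-- the number of walks of length n − 2 − k starting from a gap of k; the
-- recurrence is then the split of those walks according to whether they
-- decrease the gap all the way to 1 before jumping.
module Submission where

open import Defs
open import Data.Nat using (ℕ; _+_; _∸_; _≤_)
open import Data.Product using (_×_)
open import Relation.Binary.PropositionalEquality using (_≡_)

open import Data.Nat using (zero; suc; _<_; z≤n; s≤s; z<s; _≡ᵇ_; _<ᵇ_; _≤ᵇ_)
open import Data.Nat.Properties
open import Algebra.Properties.CommutativeSemigroup +-commutativeSemigroup using (interchange; xy∙z≈xz∙y)
open import Data.Nat.ListAction using (sum)
open import Data.Nat.ListAction.Properties using (sum-++)
open import Data.Bool using (Bool; true; false; if_then_else_; _∧_; _∨_; not; T)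
open import Data.Bool.Properties using (T-∧; ∧-zeroʳ; ∧-identityʳ; ∧-assoc; ∨-zeroʳ; ∨-identityʳ; ∨-idem; ∧-conicalˡ; ∧-conicalʳ)
open import Data.Bool.ListAction using (and; all)
open import Data.List using (List; []; _∷_; _++_; [_]; map; concatMap; length; filterᵇ)
open import Data.List.Properties using (length-++; map-++; map-∘; map-cong-local)
open import Data.List.Relation.Unary.All using (tabulate)
open import Data.List.Relation.Unary.Any using (here; there)
open import Data.List.Relation.Unary.Any.Properties using (any⁺; any⁻)
open import Data.List.Membership.Propositional using (_∈_; find; lose)
open import Data.List.Membership.Propositional.Properties using (∈-concatMap⁻; ∈-map⁻)
open import Data.Product using (Σ; ∃-syntax; _,_; proj₁; proj₂)
open import Data.Sum using (_⊎_; inj₁; inj₂)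
open import Data.Unit using (tt)
open import Data.Empty using (⊥)
open import Function using (_∘_; Equivalence)
open import Data.Nat.Solver using (module +-*-Solver)
open +-*-Solver using (solve; _:+_; _:=_; con)
open import Relation.Nullary using (¬_; yes; no; contradiction)
open import Relation.Nullary.Decidable using (dec-true; dec-false; _×-dec_)
open import Relation.Binary.Definitions using (Tri; tri<; tri≈; tri>)
open import Relation.Binary.PropositionalEquality
  using (refl; sym; trans; cong; cong₂; subst; subst₂; _≢_; module ≡-Reasoning)

-- `interval` and `φ` are defined through anonymous local helpers. Solving a
-- metavariable against their unfoldings gives those helpers a name, so that
-- they can be reasoned about by induction. The unused parameters of a lifted
-- local function are ignored by conversion, hence the dummy `0` in `range`.
mutual
  φ-from : ℕ → List ℕ → ℕ → ℕ
  φ-from = _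

  φ-unfold : ∀ f x → φ f x ≡ φ-from 1 f x
  φ-unfold f x with 1
  ... | _ = refl

  interval-go : ℕ → ℕ → ℕ → List ℕ
  interval-go = _

  interval-unfold : ∀ a b → interval a b ≡ interval-go a b (suc b ∸ a)
  interval-unfold a b with suc b ∸ a
  ... | _ = refl

range : ℕ → ℕ → List ℕ
range x m = interval-go x 0 m

range-snoc : ∀ x m → range x (suc m) ≡ range x m ++ [ x + m ]
range-snoc x zero = cong [_] (sym (+-identityʳ x))
range-snoc x (suc m) = cong (x ∷_) (trans (range-snoc (suc x) m) (cong (λ t → range (suc x) m ++ [ t ]) (sym (+-suc x m))))

∈-range⁻ : ∀ {x m y} → y ∈ range x m → x ≤ y × y < x + m
∈-range⁻ {x} {suc m} (here refl) = ≤-refl , m<m+n x z<s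
∈-range⁻ {x} {suc m} {y} (there y∈) with ∈-range⁻ y∈
... | x<y , y<x+1+m = <⇒≤ x<y , subst (y <_) (sym (+-suc x m)) y<x+1+m

∈-range⁺ : ∀ {x m y} → x ≤ y → y < x + m → y ∈ range x m
∈-range⁺ {x} {zero} x≤y y<x+0 = contradiction (subst (_ <_) (+-identityʳ x) y<x+0) (≤⇒≯ x≤y)
∈-range⁺ {x} {suc m} {y} x≤y y<x+1+m with x ≟ y
... | yes refl = here refl
... | no x≢y = there (∈-range⁺ (≤∧≢⇒< x≤y x≢y) (subst (y <_) (+-suc x m) y<x+1+m))

∈-upto⁻ : ∀ {n x} → x ∈ upto n → 1 ≤ x × x ≤ n
∈-upto⁻ x∈ with ∈-range⁻ x∈
... | 1≤x , s≤s x≤n = 1≤x , x≤n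

∈-upto⁺ : ∀ {n x} → 1 ≤ x → x ≤ n → x ∈ upto n
∈-upto⁺ 1≤x x≤n = ∈-range⁺ 1≤x (s≤s x≤n)

≡ᵇ-refl : ∀ n → (n ≡ᵇ n) ≡ true
≡ᵇ-refl n = dec-true (n ≟ n) refl

≡ᵇ-false : ∀ {m n} → m ≢ n → (m ≡ᵇ n) ≡ false
≡ᵇ-false {m} {n} = dec-false (m ≟ n)

≤ᵇ-true : ∀ {m n} → m ≤ n → (m ≤ᵇ n) ≡ true
≤ᵇ-true {m} {n} = dec-true (m ≤? n)

≤ᵇ-false : ∀ {m n} → n < m → (m ≤ᵇ n) ≡ false
≤ᵇ-false {m} {n} n<m = dec-false (m ≤? n) (<⇒≱ n<m)

≡-true⇒T : ∀ {b} → b ≡ true → T b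
≡-true⇒T refl = tt

all-cong-∈ : ∀ (p q : ℕ → Bool) xs → (∀ {x} → x ∈ xs → p x ≡ q x) → all p xs ≡ all q xs
all-cong-∈ p q xs p≗q = cong and (map-cong-local (tabulate p≗q))

sum-cong-∈ : ∀ {A : Set} (f g : A → ℕ) xs → (∀ {x} → x ∈ xs → f x ≡ g x) → sum (map f xs) ≡ sum (map g xs)
sum-cong-∈ f g xs f≗g = cong sum (map-cong-local (tabulate f≗g))

sum-map-+ : ∀ {A : Set} (f g : A → ℕ) xs → sum (map (λ x → f x + g x) xs) ≡ sum (map f xs) + sum (map g xs)
sum-map-+ f g [] = refl
sum-map-+ f g (x ∷ xs) = trans (cong (f x + g x +_) (sum-map-+ f g xs)) (interchange (f x) (g x) _ _)

sum-concatMap : ∀ {A B : Set} (w : B → ℕ) (h : A → List B) xs →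
  sum (map w (concatMap h xs)) ≡ sum (map (λ a → sum (map w (h a))) xs)
sum-concatMap w h [] = refl
sum-concatMap w h (x ∷ xs) = begin
  sum (map w (h x ++ concatMap h xs))               ≡⟨ cong sum (map-++ w (h x) (concatMap h xs)) ⟩
  sum (map w (h x) ++ map w (concatMap h xs))       ≡⟨ sum-++ (map w (h x)) _ ⟩
  sum (map w (h x)) + sum (map w (concatMap h xs))  ≡⟨ cong (sum (map w (h x)) +_) (sum-concatMap w h xs) ⟩
  sum (map w (h x)) + sum (map (λ a → sum (map w (h a))) xs) ∎
  where open ≡-Reasoning

length-filterᵇ : ∀ {A : Set} (p : A → Bool) xs → length (filterᵇ p xs) ≡ sum (map (λ x → if p x then 1 else 0) xs)
length-filterᵇ p [] = refl
length-filterᵇ p (x ∷ xs) with p x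
... | true = cong suc (length-filterᵇ p xs)
... | false = length-filterᵇ p xs

sum-range-indicator-below : ∀ (G : ℕ → ℕ) c x m → c < x → sum (map (λ v → if v ≡ᵇ c then G v else 0) (range x m)) ≡ 0
sum-range-indicator-below G c x zero c<x = refl
sum-range-indicator-below G c x (suc m) c<x rewrite ≡ᵇ-false (>⇒≢ c<x) =
  sum-range-indicator-below G c (suc x) m (m≤n⇒m≤1+n c<x)

sum-range-indicator : ∀ (G : ℕ → ℕ) c x m → x ≤ c → c < x + m →
  sum (map (λ v → if v ≡ᵇ c then G v else 0) (range x m)) ≡ G c
sum-range-indicator G c x zero x≤c c<x+0 = contradiction (subst (c <_) (+-identityʳ x) c<x+0) (≤⇒≯ x≤c)
sum-range-indicator G c x (suc m) x≤c c<x+1+m with x ≟ c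
... | yes refl rewrite ≡ᵇ-refl x =
  trans (cong (G x +_) (sum-range-indicator-below G x (suc x) m ≤-refl)) (+-identityʳ (G x))
... | no x≢c rewrite ≡ᵇ-false x≢c =
  sum-range-indicator G c (suc x) m (≤∧≢⇒< x≤c x≢c) (subst (c <_) (+-suc x m) c<x+1+m)

transp-fst : ∀ a b → transp a b a ≡ b
transp-fst a b rewrite ≡ᵇ-refl a = refl

transp-snd : ∀ a b → b ≢ a → transp a b b ≡ a
transp-snd a b b≢a rewrite ≡ᵇ-false b≢a | ≡ᵇ-refl b = refl

transp-other : ∀ a b x → x ≢ a → x ≢ b → transp a b x ≡ x
transp-other a b x x≢a x≢b rewrite ≡ᵇ-false x≢a | ≡ᵇ-false x≢b = refl

data TranspView (n v y : ℕ) : Set where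
  fixed   : y ≢ v → transp (suc n) v y ≡ y → TranspView n v y
  swapped : y ≡ v → transp (suc n) v y ≡ suc n → TranspView n v y

transp-view : ∀ n v y → y ≤ n → TranspView n v y
transp-view n v y y≤n with y ≟ v
... | yes refl = swapped refl (transp-snd (suc n) y (<⇒≢ (s≤s y≤n)))
... | no y≢v = fixed y≢v (transp-other (suc n) v y (<⇒≢ (s≤s y≤n)) y≢v)

transp-≤ : ∀ n v y → y ≤ n → transp (suc n) v y ≤ suc n
transp-≤ n v y y≤n with transp-view n v y y≤n
... | fixed _ e = subst (_≤ suc n) (sym e) (m≤n⇒m≤1+n y≤n)
... | swapped _ e = subst (_≤ suc n) (sym e) ≤-refl

φ-from-snoc : ∀ i g v x → φ-from i (g ++ [ v ]) x ≡ transp (i + length g) v (φ-from i g x)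
φ-from-snoc i [] v x = cong (λ j → transp j v x) (sym (+-identityʳ i))
φ-from-snoc i (w ∷ g) v x = trans (φ-from-snoc (suc i) g v (transp i w x)) (cong (λ j → transp j v (φ-from i (w ∷ g) x)) (sym (+-suc i (length g))))

φ-snoc : ∀ {n} g v x → length g ≡ n → φ (g ++ [ v ]) x ≡ transp (suc n) v (φ g x)
φ-snoc g v x refl = φ-from-snoc 1 g v x

at-snoc-init : ∀ {n} g v i → length g ≡ n → i ≤ n → at (g ++ [ v ]) i ≡ at g i
at-snoc-init [] v zero _ _ = refl
at-snoc-init (w ∷ g) v zero _ _ = refl
at-snoc-init [] v (suc i) refl ()
at-snoc-init (w ∷ g) v (suc zero) _ _ = refl
at-snoc-init (w ∷ g) v (suc (suc i)) refl (s≤s i<n) = at-snoc-init g v (suc i) refl i<n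

at-snoc-last : ∀ {n} g v → length g ≡ n → at (g ++ [ v ]) (suc n) ≡ v
at-snoc-last [] v refl = refl
at-snoc-last (w ∷ g) v refl = at-snoc-last g v refl

∈-subexceedant-suc⁻ : ∀ {n g} → g ∈ subexceedant (suc n) →
  ∃[ h ] ∃[ v ] h ∈ subexceedant n × v ∈ upto (suc n) × g ≡ h ++ [ v ]
∈-subexceedant-suc⁻ {n} g∈ with find (∈-concatMap⁻ (λ h → map (λ v → h ++ [ v ]) (upto (suc n))) {xs = subexceedant n} g∈)
... | h , h∈ , g∈map with ∈-map⁻ (λ v → h ++ [ v ]) g∈map
... | v , v∈ , g≡ = h , v , h∈ , v∈ , g≡

record SubexceedantWord (n : ℕ) (g : List ℕ) : Set where
  field
    length≡   : length g ≡ n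
    φ-bounded : ∀ x → 1 ≤ x → x ≤ n → 1 ≤ φ g x × φ g x ≤ n
    φ-fixes   : ∀ x → n < x → φ g x ≡ x
    φ-last    : 1 ≤ n → φ g n ≡ at g n

open SubexceedantWord

subexceedantWord-snoc : ∀ {n h v} → SubexceedantWord n h → 1 ≤ v → v ≤ suc n → SubexceedantWord (suc n) (h ++ [ v ])
subexceedantWord-snoc {n} {h} {v} S 1≤v v≤1+n = record
  { length≡   = trans (length-++ h) (trans (+-comm (length h) 1) (cong suc (length≡ S)))
  ; φ-bounded = bounded
  ; φ-fixes   = fixes
  ; φ-last    = λ _ → trans last (sym (at-snoc-last h v (length≡ S)))
  }
  where
  snoc : ∀ x → φ (h ++ [ v ]) x ≡ transp (suc n) v (φ h x)
  snoc x = φ-snoc h v x (length≡ S)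
  last : φ (h ++ [ v ]) (suc n) ≡ v
  last = trans (snoc (suc n)) (trans (cong (transp (suc n) v) (φ-fixes S (suc n) ≤-refl)) (transp-fst (suc n) v))
  bounded : ∀ x → 1 ≤ x → x ≤ suc n → 1 ≤ φ (h ++ [ v ]) x × φ (h ++ [ v ]) x ≤ suc n
  bounded x 1≤x x≤1+n with m≤n⇒m<n∨m≡n x≤1+n
  ... | inj₂ refl = subst (λ y → 1 ≤ y × y ≤ suc n) (sym last) (1≤v , v≤1+n)
  ... | inj₁ (s≤s x≤n) with φ-bounded S x 1≤x x≤n | transp-view n v (φ h x) (proj₂ (φ-bounded S x 1≤x x≤n))
  ...   | 1≤y , y≤n | fixed _ e = subst (λ y → 1 ≤ y × y ≤ suc n) (sym (trans (snoc x) e)) (1≤y , m≤n⇒m≤1+n y≤n)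
  ...   | _ | swapped _ e = subst (λ y → 1 ≤ y × y ≤ suc n) (sym (trans (snoc x) e)) (s≤s z≤n , ≤-refl)
  fixes : ∀ x → suc n < x → φ (h ++ [ v ]) x ≡ x
  fixes x 1+n<x = trans (snoc x) (trans (cong (transp (suc n) v) (φ-fixes S x (<-trans (n<1+n n) 1+n<x)))
    (transp-other (suc n) v x (>⇒≢ 1+n<x) (>⇒≢ (≤-<-trans v≤1+n 1+n<x))))

subexceedantWord : ∀ n g → g ∈ subexceedant n → SubexceedantWord n g
subexceedantWord zero .[] (here refl) = record
  { length≡ = refl ; φ-bounded = λ x 1≤x x≤0 → contradiction (≤-trans 1≤x x≤0) λ () ; φ-fixes = λ _ _ → refl ; φ-last = λ () }
subexceedantWord (suc n) g g∈ with ∈-subexceedant-suc⁻ g∈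
... | h , v , h∈ , v∈ , refl = subexceedantWord-snoc (subexceedantWord n h h∈) (proj₁ (∈-upto⁻ v∈)) (proj₂ (∈-upto⁻ v∈))

record Pattern132 (n : ℕ) (σ : ℕ → ℕ) : Set where
  constructor pattern132
  field
    i j k : ℕ
    1≤i : 1 ≤ i
    i<j : i < j
    j<k : j < k
    k≤n : k ≤ n
    σi<σk : σ i < σ k
    σk<σj : σ k < σ j

contains132⇒Pattern132 : ∀ n σ → T (contains132 n σ) → Pattern132 n σ
contains132⇒Pattern132 n σ c with find (any⁻ _ (upto n) c)
... | i , i∈ , ci with find (any⁻ _ (upto n) ci)
... | j , _ , cj with find (any⁻ _ (upto n) cj)
... | k , k∈ , cijk with Equivalence.to T-∧ cijk
... | i<ᵇj , rest with Equivalence.to T-∧ rest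
... | j<ᵇk , rest′ with Equivalence.to T-∧ rest′
... | σi<ᵇσk , σk<ᵇσj =
  pattern132 i j k (proj₁ (∈-upto⁻ i∈)) (<ᵇ⇒< i j i<ᵇj) (<ᵇ⇒< j k j<ᵇk) (proj₂ (∈-upto⁻ k∈))
    (<ᵇ⇒< (σ i) (σ k) σi<ᵇσk) (<ᵇ⇒< (σ k) (σ j) σk<ᵇσj)

Pattern132⇒contains132 : ∀ n σ → Pattern132 n σ → T (contains132 n σ)
Pattern132⇒contains132 n σ (pattern132 i j k 1≤i i<j j<k k≤n σi<σk σk<σj) =
  any⁺ _ (lose (∈-upto⁺ 1≤i i≤n) (any⁺ _ (lose (∈-upto⁺ 1≤j j≤n) (any⁺ _ (lose (∈-upto⁺ 1≤k k≤n)
    (Equivalence.from T-∧ (<⇒<ᵇ i<j , Equivalence.from T-∧ (<⇒<ᵇ j<k ,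
      Equivalence.from T-∧ (<⇒<ᵇ σi<σk , <⇒<ᵇ σk<σj)))))))))
  where
  j≤n : j ≤ n
  j≤n = ≤-trans (<⇒≤ j<k) k≤n
  i≤n : i ≤ n
  i≤n = ≤-trans (<⇒≤ i<j) j≤n
  1≤j : 1 ≤ j
  1≤j = ≤-trans 1≤i (<⇒≤ i<j)
  1≤k : 1 ≤ k
  1≤k = ≤-trans 1≤j (<⇒≤ j<k)

avoids132-true : ∀ n σ → ¬ Pattern132 n σ → avoids132 n σ ≡ true
avoids132-true n σ no-pattern with contains132 n σ in eq
... | true = contradiction (contains132⇒Pattern132 n σ (≡-true⇒T eq)) no-pattern
... | false = refl

avoids132-false : ∀ n σ → Pattern132 n σ → avoids132 n σ ≡ false
avoids132-false n σ p with contains132 n σ | Pattern132⇒contains132 n σ p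
... | true | _ = refl

Pattern132-cong : ∀ {n σ τ} → (∀ x → σ x ≡ τ x) → Pattern132 n σ → Pattern132 n τ
Pattern132-cong σ≗τ (pattern132 i j k 1≤i i<j j<k k≤n σi<σk σk<σj) =
  pattern132 i j k 1≤i i<j j<k k≤n (subst₂ _<_ (σ≗τ i) (σ≗τ k) σi<σk) (subst₂ _<_ (σ≗τ k) (σ≗τ j) σk<σj)

Pattern132-length≥3 : ∀ {n σ} → Pattern132 n σ → 3 ≤ n
Pattern132-length≥3 (pattern132 i j k 1≤i i<j j<k k≤n _ _) = ≤-trans (s≤s (≤-trans (s≤s 1≤i) i<j)) (≤-trans j<k k≤n)

record Summary : Set where
  constructor summary
  field
    last head plateaus : ℕ

summarise : ℕ → List ℕ → Summary
summarise n f = summary (at f n) (φ f 1) (plateaus1 n f)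

advance : ℕ → Summary → ℕ → Summary
advance n (summary a b p) v = summary v (transp (suc n) v b) (p + (if (a ≡ᵇ 1) ∧ (v ≡ᵇ 1) then 1 else 0))

all-snoc : ∀ (p : ℕ → Bool) xs y → all p (xs ++ [ y ]) ≡ all p xs ∧ p y
all-snoc p [] y = ∧-identityʳ (p y)
all-snoc p (x ∷ xs) y = trans (cong (p x ∧_) (all-snoc p xs y)) (sym (∧-assoc (p x) _ _))

module Snoc (m : ℕ) (g : List ℕ) (v : ℕ) (length≡ : length g ≡ suc m) where
  g′ : List ℕ
  g′ = g ++ [ v ]

  at-init : ∀ {y} → y ∈ range 1 m → at g′ y ≡ at g y × at g′ (suc y) ≡ at g (suc y)
  at-init y∈ with ∈-range⁻ y∈
  ... | _ , s≤s y<1+m = at-snoc-init g v _ length≡ (m≤n⇒m≤1+n y<1+m) , at-snoc-init g v _ length≡ (s≤s y<1+m)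

  at-last : at g′ (suc m) ≡ at g (suc m) × at g′ (suc (suc m)) ≡ v
  at-last = at-snoc-init g v (suc m) length≡ ≤-refl , at-snoc-last g v length≡

  nondecreasing-snoc : nondecreasing (suc (suc m)) g′ ≡ nondecreasing (suc m) g ∧ (at g (suc m) ≤ᵇ v)
  nondecreasing-snoc = begin
    all p′ (range 1 (suc m))          ≡⟨ cong (all p′) (range-snoc 1 m) ⟩
    all p′ (range 1 m ++ [ suc m ])   ≡⟨ all-snoc p′ (range 1 m) (suc m) ⟩
    all p′ (range 1 m) ∧ p′ (suc m)   ≡⟨ cong₂ _∧_ (all-cong-∈ p′ p (range 1 m) (ok ∘ at-init))
                                                  (ok at-last) ⟩
    all p (range 1 m) ∧ (at g (suc m) ≤ᵇ v) ∎
    where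
    open ≡-Reasoning
    p p′ : ℕ → Bool
    p  i = at g i ≤ᵇ at g (suc i)
    p′ i = at g′ i ≤ᵇ at g′ (suc i)
    ok : ∀ {a b c d} → a ≡ b × c ≡ d → (a ≤ᵇ c) ≡ (b ≤ᵇ d)
    ok (a≡b , c≡d) = cong₂ _≤ᵇ_ a≡b c≡d

  noFixedPointAbove1-snoc : noFixedPointAbove1 (suc (suc m)) g′ ≡ noFixedPointAbove1 (suc m) g ∧ not (v ≡ᵇ suc (suc m))
  noFixedPointAbove1-snoc = begin
    all q′ (range 2 (suc m))                ≡⟨ cong (all q′) (range-snoc 2 m) ⟩
    all q′ (range 2 m ++ [ suc (suc m) ])   ≡⟨ all-snoc q′ (range 2 m) (suc (suc m)) ⟩
    all q′ (range 2 m) ∧ q′ (suc (suc m))   ≡⟨ cong₂ _∧_ (all-cong-∈ q′ q (range 2 m) init)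
                                                        (cong (λ t → not (t ≡ᵇ suc (suc m))) (proj₂ at-last)) ⟩
    all q (range 2 m) ∧ not (v ≡ᵇ suc (suc m)) ∎
    where
    open ≡-Reasoning
    q q′ : ℕ → Bool
    q  i = not (at g i ≡ᵇ i)
    q′ i = not (at g′ i ≡ᵇ i)
    init : ∀ {y} → y ∈ range 2 m → q′ y ≡ q y
    init y∈ with ∈-range⁻ y∈
    ... | _ , s≤s y<2+m = cong (λ t → not (t ≡ᵇ _)) (at-snoc-init g v _ length≡ y<2+m)

  plateaus1-snoc : plateaus1 (suc (suc m)) g′ ≡ plateaus1 (suc m) g + (if (at g (suc m) ≡ᵇ 1) ∧ (v ≡ᵇ 1) then 1 else 0)
  plateaus1-snoc = begin
    length (filterᵇ r′ (range 1 (suc m)))               ≡⟨ length-filterᵇ r′ (range 1 (suc m)) ⟩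
    sum (map (𝟙 ∘ r′) (range 1 (suc m)))                ≡⟨ cong (sum ∘ map (𝟙 ∘ r′)) (range-snoc 1 m) ⟩
    sum (map (𝟙 ∘ r′) (range 1 m ++ [ suc m ]))         ≡⟨ cong sum (map-++ (𝟙 ∘ r′) (range 1 m) [ suc m ]) ⟩
    sum (map (𝟙 ∘ r′) (range 1 m) ++ [ 𝟙 (r′ (suc m)) ]) ≡⟨ sum-++ (map (𝟙 ∘ r′) (range 1 m)) _ ⟩
    sum (map (𝟙 ∘ r′) (range 1 m)) + (𝟙 (r′ (suc m)) + 0)
      ≡⟨ cong₂ _+_ (sum-cong-∈ (𝟙 ∘ r′) (𝟙 ∘ r) (range 1 m) (cong 𝟙 ∘ ok ∘ at-init))
                   (trans (+-identityʳ _) (cong 𝟙 (ok at-last))) ⟩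
    sum (map (𝟙 ∘ r) (range 1 m)) + 𝟙 ((at g (suc m) ≡ᵇ 1) ∧ (v ≡ᵇ 1))
      ≡⟨ cong (_+ 𝟙 ((at g (suc m) ≡ᵇ 1) ∧ (v ≡ᵇ 1))) (sym (length-filterᵇ r (range 1 m))) ⟩
    length (filterᵇ r (range 1 m)) + 𝟙 ((at g (suc m) ≡ᵇ 1) ∧ (v ≡ᵇ 1)) ∎
    where
    open ≡-Reasoning
    𝟙 : Bool → ℕ
    𝟙 b = if b then 1 else 0
    r r′ : ℕ → Bool
    r  i = (at g i ≡ᵇ 1) ∧ (at g (suc i) ≡ᵇ 1)
    r′ i = (at g′ i ≡ᵇ 1) ∧ (at g′ (suc i) ≡ᵇ 1)
    ok : ∀ {a b c d} → a ≡ b × c ≡ d → ((a ≡ᵇ 1) ∧ (c ≡ᵇ 1)) ≡ ((b ≡ᵇ 1) ∧ (d ≡ᵇ 1))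
    ok (a≡b , c≡d) = cong₂ (λ s t → (s ≡ᵇ 1) ∧ (t ≡ᵇ 1)) a≡b c≡d

  summarise-snoc : summarise (suc (suc m)) g′ ≡ advance (suc m) (summarise (suc m) g) v
  summarise-snoc
    rewrite proj₂ at-last | φ-snoc g v 1 length≡ | plateaus1-snoc = refl

Obstruction : ℕ → (ℕ → ℕ) → ℕ → Set
Obstruction n σ a = Σ (Pattern132 n σ) λ p → σ (Pattern132.i p) < a

module Extension (n v : ℕ) (σ : ℕ → ℕ)
  (σ≤n : ∀ x → 1 ≤ x → x ≤ n → σ x ≤ n) (σ-fix : σ (suc n) ≡ suc n) where

  σ′ : ℕ → ℕ
  σ′ x = transp (suc n) v (σ x)

  σ′-last : σ′ (suc n) ≡ v
  σ′-last = trans (cong (transp (suc n) v) σ-fix) (transp-fst (suc n) v)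

  σ′-view : ∀ x → 1 ≤ x → x ≤ n → TranspView n v (σ x)
  σ′-view x 1≤x x≤n = transp-view n v (σ x) (σ≤n x 1≤x x≤n)

  σ′≤1+n : ∀ x → 1 ≤ x → x ≤ n → σ′ x ≤ suc n
  σ′≤1+n x 1≤x x≤n = transp-≤ n v (σ x) (σ≤n x 1≤x x≤n)

  σ′≡σ : ∀ x → 1 ≤ x → x ≤ n → σ′ x < suc n → σ′ x ≡ σ x
  σ′≡σ x 1≤x x≤n σ′x<1+n with σ′-view x 1≤x x≤n
  ... | fixed _ e = e
  ... | swapped _ e = contradiction e (<⇒≢ σ′x<1+n)

  σ′≡σ-below : ∀ x → 1 ≤ x → x ≤ n → σ x < v → σ′ x ≡ σ x
  σ′≡σ-below x 1≤x x≤n σx<v with σ′-view x 1≤x x≤n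
  ... | fixed _ e = e
  ... | swapped σx≡v _ = contradiction σx≡v (<⇒≢ σx<v)

  NoPatternThroughTop : Set
  NoPatternThroughTop = ∀ x q y → 1 ≤ x → x < q → q < y → y ≤ n → σ q ≡ v → σ x < σ y → ⊥

  NoPatternThroughLast : Set
  NoPatternThroughLast = ∀ x y → 1 ≤ x → x < y → y ≤ n → σ′ x < v → v < σ′ y → ⊥

  avoids-snoc : ¬ Pattern132 n σ → NoPatternThroughTop → NoPatternThroughLast → ¬ Pattern132 (suc n) σ′
  avoids-snoc no-pattern no-top no-last (pattern132 i j k 1≤i i<j j<k k≤1+n σ′i<σ′k σ′k<σ′j)
    with m≤n⇒m<n∨m≡n k≤1+n
  ... | inj₂ refl = no-last i j 1≤i i<j (≤-pred j<k) (subst (σ′ i <_) σ′-last σ′i<σ′k) (subst (_< σ′ j) σ′-last σ′k<σ′j)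
  ... | inj₁ (s≤s k≤n) = by-middle-entry (σ′-view j 1≤j j≤n)
    where
    1≤j : 1 ≤ j
    1≤j = ≤-trans 1≤i (<⇒≤ i<j)
    j≤n : j ≤ n
    j≤n = ≤-trans (<⇒≤ j<k) k≤n
    σ′j≤1+n : σ′ j ≤ suc n
    σ′j≤1+n = σ′≤1+n j 1≤j j≤n
    σ′k≡σk : σ′ k ≡ σ k
    σ′k≡σk = σ′≡σ k (≤-trans 1≤j (<⇒≤ j<k)) k≤n (<-≤-trans σ′k<σ′j σ′j≤1+n)
    σ′i≡σi : σ′ i ≡ σ i
    σ′i≡σi = σ′≡σ i 1≤i (≤-trans (<⇒≤ i<j) j≤n) (<-≤-trans (<-trans σ′i<σ′k σ′k<σ′j) σ′j≤1+n)
    σi<σk : σ i < σ k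
    σi<σk = subst₂ _<_ σ′i≡σi σ′k≡σk σ′i<σ′k
    by-middle-entry : TranspView n v (σ j) → ⊥
    by-middle-entry (swapped σj≡v _) = no-top i j k 1≤i i<j j<k k≤n σj≡v σi<σk
    by-middle-entry (fixed _ σ′j≡σj) =
      no-pattern (pattern132 i j k 1≤i i<j j<k k≤n σi<σk (subst₂ _<_ σ′k≡σk σ′j≡σj σ′k<σ′j))

  obstruction-through-last : ∀ x q → 1 ≤ x → x < q → q ≤ n → σ q ≡ v → σ x < v → v ≤ n → Obstruction (suc n) σ′ v
  obstruction-through-last x q 1≤x x<q q≤n σq≡v σx<v v≤n =
    pattern132 x q (suc n) 1≤x x<q (s≤s q≤n) ≤-refl
      (subst₂ _<_ (sym σ′x≡σx) (sym σ′-last) σx<v)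
      (subst₂ _<_ (sym σ′-last) (sym σ′q≡1+n) (s≤s v≤n))
    , subst (_< v) (sym σ′x≡σx) σx<v
    where
    σ′x≡σx : σ′ x ≡ σ x
    σ′x≡σx = σ′≡σ-below x 1≤x (≤-trans (<⇒≤ x<q) q≤n) σx<v
    σ′q≡1+n : σ′ q ≡ suc n
    σ′q≡1+n = trans (cong (transp (suc n) v) σq≡v) (transp-snd (suc n) v (<⇒≢ (s≤s v≤n)))

  obstruction-snoc : ∀ {a} → Obstruction n σ a → a ≤ v → Obstruction (suc n) σ′ v
  obstruction-snoc (pattern132 i j k 1≤i i<j j<k k≤n σi<σk σk<σj , σi<a) a≤v =
    by-last-entry (σ′-view k 1≤k k≤n)
    where
    1≤j : 1 ≤ j
    1≤j = ≤-trans 1≤i (<⇒≤ i<j)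
    1≤k : 1 ≤ k
    1≤k = ≤-trans 1≤j (<⇒≤ j<k)
    j≤n : j ≤ n
    j≤n = ≤-trans (<⇒≤ j<k) k≤n
    σi<v : σ i < v
    σi<v = <-≤-trans σi<a a≤v
    σ′i≡σi : σ′ i ≡ σ i
    σ′i≡σi = σ′≡σ-below i 1≤i (≤-trans (<⇒≤ i<j) j≤n) σi<v
    σ′i<v : σ′ i < v
    σ′i<v = subst (_< v) (sym σ′i≡σi) σi<v
    σ′i<σ′last : σ′ i < σ′ (suc n)
    σ′i<σ′last = subst (σ′ i <_) (sym σ′-last) σ′i<v
    by-last-entry : TranspView n v (σ k) → Obstruction (suc n) σ′ v
    by-last-entry (swapped σk≡v _) with σ′-view j 1≤j j≤n
    ... | fixed _ σ′j≡σj = pattern132 i j (suc n) 1≤i i<j (s≤s j≤n) ≤-refl σ′i<σ′last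
                              (subst₂ _<_ (trans σk≡v (sym σ′-last)) (sym σ′j≡σj) σk<σj) , σ′i<v
    ... | swapped σj≡v _ = contradiction (trans σk≡v (sym σj≡v)) (<⇒≢ σk<σj)
    by-last-entry (fixed _ σ′k≡σk) with σ′-view j 1≤j j≤n
    ... | fixed _ σ′j≡σj = pattern132 i j k 1≤i i<j j<k (m≤n⇒m≤1+n k≤n)
                              (subst₂ _<_ (sym σ′i≡σi) (sym σ′k≡σk) σi<σk) (subst₂ _<_ (sym σ′k≡σk) (sym σ′j≡σj) σk<σj) , σ′i<v
    ... | swapped _ σ′j≡1+n = pattern132 i j k 1≤i i<j j<k (m≤n⇒m≤1+n k≤n)
                                 (subst₂ _<_ (sym σ′i≡σi) (sym σ′k≡σk) σi<σk) (subst₂ _<_ (sym σ′k≡σk) (sym σ′j≡1+n) (s≤s (σ≤n k 1≤k k≤n))) , σ′i<v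

module Appended {n f} (S : SubexceedantWord n f) (v : ℕ) where
  σ≤n : ∀ x → 1 ≤ x → x ≤ n → φ f x ≤ n
  σ≤n x 1≤x x≤n = proj₂ (φ-bounded S x 1≤x x≤n)

  open Extension n v (φ f) σ≤n (φ-fixes S (suc n) ≤-refl) public

  g′ : List ℕ
  g′ = f ++ [ v ]

  snoc : ∀ x → φ g′ x ≡ σ′ x
  snoc x = φ-snoc f v x (length≡ S)

  φ-new : φ g′ (suc n) ≡ v
  φ-new = trans (snoc (suc n)) σ′-last

  at-new : at g′ (suc n) ≡ v
  at-new = at-snoc-last f v (length≡ S)

  unmoved : ∀ x → 1 ≤ x → x ≤ n → φ f x ≢ v → φ g′ x ≡ φ f x
  unmoved x 1≤x x≤n σx≢v = trans (snoc x) (transp-other (suc n) v (φ f x) (<⇒≢ (s≤s (σ≤n x 1≤x x≤n))) σx≢v)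

  obstruction′ : Obstruction (suc n) σ′ v → Obstruction (suc n) (φ g′) (at g′ (suc n))
  obstruction′ (p , σ′i<v) = Pattern132-cong (sym ∘ snoc) p , subst₂ _<_ (sym (snoc _)) (sym at-new) σ′i<v

obstruction-persists : ∀ {n f v} → SubexceedantWord n f → Obstruction n (φ f) (at f n) → at f n ≤ v →
  Obstruction (suc n) (φ (f ++ [ v ])) (at (f ++ [ v ]) (suc n))
obstruction-persists {v = v} S O fn≤v = obstruction′ (obstruction-snoc O fn≤v)
  where open Appended S v

-- In one-line notation φ(f) = b (b+1) ⋯ n | (a+1) ⋯ (b−1) | w, where the last
-- block w consists of the a values 1, …, a and e + 1 = n − b + 1 is the length
-- of the first block.
record Shape (n : ℕ) (f : List ℕ) : Set where
  field
    a b e        : ℕ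
    a≡           : at f n ≡ a
    b≡           : φ f 1 ≡ b
    b+e≡n        : b + e ≡ n
    1≤a          : 1 ≤ a
    a<b          : a < b
    first-block  : ∀ j → j ≤ e → φ f (suc j) ≡ b + j
    middle-block : ∀ j → suc (a + j) < b → φ f (suc (suc (e + j))) ≡ suc (a + j)
    last-block   : ∀ x → x ≤ n → n < x + a → 1 ≤ φ f x × φ f x ≤ a
    one-before   : 2 ≤ a → ∃[ x ] 1 ≤ x × x < n × φ f x ≡ 1
    a≡1⇒b≡2      : a ≡ 1 → b ≡ 2
    avoids       : ¬ Pattern132 n (φ f)

admissible : ℕ → ℕ → ℕ → Bool
admissible a b v = (v ≡ᵇ suc a) ∨ ((v ≡ᵇ b) ∨ ((v ≡ᵇ 1) ∧ (a ≡ᵇ 1)))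

admissible-succ : ∀ a b → admissible a b (suc a) ≡ true
admissible-succ a b rewrite ≡ᵇ-refl a = refl

admissible-head : ∀ a b → admissible a b b ≡ true
admissible-head a b rewrite ≡ᵇ-refl b = ∨-zeroʳ (b ≡ᵇ suc a)

admissible-one : ∀ {a} b → a ≡ 1 → admissible a b 1 ≡ true
admissible-one b refl = ∨-zeroʳ (1 ≡ᵇ b)

admissible-false : ∀ {a b v} → v ≢ suc a → v ≢ b → ¬ (v ≡ 1 × a ≡ 1) → admissible a b v ≡ false
admissible-false {a} {b} {v} v≢1+a v≢b ¬v≡1≡a rewrite ≡ᵇ-false v≢1+a | ≡ᵇ-false v≢b with v ≟ 1
... | yes refl rewrite ≡ᵇ-false (λ a≡1 → ¬v≡1≡a (refl , a≡1)) = refl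
... | no v≢1 rewrite ≡ᵇ-false v≢1 = refl

module Grow {n f} (J : Shape n f) (S : SubexceedantWord n f) where
  open Shape J public

  σ : ℕ → ℕ
  σ = φ f

  b≤n : b ≤ n
  b≤n = subst (b ≤_) b+e≡n (m≤m+n b e)

  a<n : a < n
  a<n = <-≤-trans a<b b≤n

  1≤n : 1 ≤ n
  1≤n = ≤-trans 1≤a (<⇒≤ a<n)

  2≤b : 2 ≤ b
  2≤b = <-≤-trans (s≤s 1≤a) a<b

  1+b+e≡1+n : b + suc e ≡ suc n
  1+b+e≡1+n = trans (+-suc b e) (cong suc b+e≡n)

  ≱2⇒a≡1 : ¬ (2 ≤ a) → a ≡ 1
  ≱2⇒a≡1 2≰a = ≤-antisym (≤-pred (≰⇒> 2≰a)) 1≤a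

  1≤σ : ∀ x → 1 ≤ x → x ≤ n → 1 ≤ σ x
  1≤σ x 1≤x x≤n = proj₁ (φ-bounded S x 1≤x x≤n)

  σn≡a : σ n ≡ a
  σn≡a = trans (φ-last S 1≤n) a≡

  1+j≤n : ∀ j → j ≤ e → suc j ≤ n
  1+j≤n j j≤e = subst (suc j ≤_) b+e≡n (+-mono-≤ (≤-trans (s≤s z≤n) 2≤b) j≤e)

  2+e+j≤n : ∀ j → suc (a + j) < b → suc (suc (e + j)) ≤ n
  2+e+j≤n j 1+a+j<b = begin
    suc (suc (e + j)) ≡⟨ cong suc (+-suc e j) ⟨
    suc (e + suc j)   ≡⟨ +-suc e (suc j) ⟨
    e + suc (suc j)   ≤⟨ +-monoʳ-≤ e (<⇒≤ (≤-<-trans (s≤s (+-monoˡ-≤ j 1≤a)) 1+a+j<b)) ⟩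
    e + b             ≡⟨ +-comm e b ⟩
    b + e             ≡⟨ b+e≡n ⟩
    n                 ∎
    where open ≤-Reasoning

  past-middle : ∀ j → b ≤ suc (a + j) → n < suc (suc (e + j)) + a
  past-middle j b≤1+a+j = subst (_< suc (suc (e + j)) + a) b+e≡n
    (≤-<-trans (+-monoˡ-≤ e b≤1+a+j) (subst (_< suc (suc (e + j + a))) (sym (rearrange a j e)) (n<1+n _)))
    where
    rearrange : ∀ a j e → suc (a + j) + e ≡ suc (e + j + a)
    rearrange = solve 3 (λ a j e → con 1 :+ a :+ j :+ e := con 1 :+ e :+ j :+ a) refl

  position-view : ∀ x → 1 ≤ x → (∃[ j ] j ≤ e × x ≡ suc j) ⊎ (∃[ j ] x ≡ suc (suc (e + j)))
  position-view (suc x) _ with x ≤? e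
  ... | yes x≤e = inj₁ (x , x≤e , refl)
  ... | no x≰e with m≤n⇒∃[o]m+o≡n (≰⇒> x≰e)
  ...   | j , 1+e+j≡x = inj₂ (j , cong suc (sym 1+e+j≡x))

  data AfterFirstBlock (j : ℕ) : Set where
    middle : suc (a + j) < b → σ (suc (suc (e + j))) ≡ suc (a + j) → AfterFirstBlock j
    last   : b ≤ suc (a + j) → 1 ≤ σ (suc (suc (e + j))) → σ (suc (suc (e + j))) ≤ a → AfterFirstBlock j

  after-first-block : ∀ j → suc (suc (e + j)) ≤ n → AfterFirstBlock j
  after-first-block j 2+e+j≤n with suc (a + j) <? b
  ... | yes 1+a+j<b = middle 1+a+j<b (middle-block j 1+a+j<b)
  ... | no 1+a+j≮b with last-block _ 2+e+j≤n (past-middle j (≮⇒≥ 1+a+j≮b))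
  ...   | 1≤σx , σx≤a = last (≮⇒≥ 1+a+j≮b) 1≤σx σx≤a

  first-block-≥ : ∀ x → 1 ≤ x → x ≤ suc e → b ≤ σ x
  first-block-≥ (suc j) _ (s≤s j≤e) = subst (b ≤_) (sym (first-block j j≤e)) (m≤m+n b j)

  after-first-block-< : ∀ x → suc e < x → x ≤ n → 1 ≤ σ x × σ x < b
  after-first-block-< x 1+e<x x≤n with m≤n⇒∃[o]m+o≡n 1+e<x
  ... | j , refl with after-first-block j x≤n
  ...   | middle 1+a+j<b σx≡ = subst (λ y → 1 ≤ y × y < b) (sym σx≡) (s≤s z≤n , 1+a+j<b)
  ...   | last _ 1≤σx σx≤a = 1≤σx , ≤-<-trans σx≤a a<b

  module Append (v : ℕ) where
    open Appended S v public

    avoids′ : NoPatternThroughTop → NoPatternThroughLast → ¬ Pattern132 (suc n) (φ g′)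
    avoids′ no-top no-last = avoids-snoc avoids no-top no-last ∘ Pattern132-cong snoc

    one-before-kept : 2 ≤ v → ∃[ x ] 1 ≤ x × x < suc n × φ g′ x ≡ 1
    one-before-kept 2≤v with 2 ≤? a
    ... | yes 2≤a with one-before 2≤a
    ...   | x , 1≤x , x<n , σx≡1 = x , 1≤x , m≤n⇒m≤1+n x<n , trans (unmoved x 1≤x (<⇒≤ x<n) (σ≢v σx≡1)) σx≡1
      where
      σ≢v : ∀ {x} → σ x ≡ 1 → σ x ≢ v
      σ≢v σx≡1 σx≡v = <⇒≢ 2≤v (trans (sym σx≡1) σx≡v)
    one-before-kept 2≤v | no 2≰a = n , 1≤n , ≤-refl , trans (unmoved n 1≤n ≤-refl σn≢v) σn≡1
      where
      σn≡1 : σ n ≡ 1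
      σn≡1 = trans σn≡a (≱2⇒a≡1 2≰a)
      σn≢v : σ n ≢ v
      σn≢v σn≡v = <⇒≢ 2≤v (trans (sym σn≡1) σn≡v)

  module AppendHead where
    open Append b

    φ-first : φ g′ 1 ≡ suc n
    φ-first = trans (snoc 1) (trans (cong (transp (suc n) b) b≡) (transp-snd (suc n) b (<⇒≢ (s≤s b≤n))))

    no-top : NoPatternThroughTop
    no-top x q y 1≤x x<q q<y y≤n σq≡b _ with position-view q (≤-trans 1≤x (<⇒≤ x<q))
    ... | inj₁ (j , j≤e , refl) = <⇒≱ x<q (subst (λ t → suc t ≤ x) (sym j≡0) 1≤x)
      where
      j≡0 : j ≡ 0
      j≡0 = +-cancelˡ-≡ b j 0 (trans (sym (first-block j j≤e)) (trans σq≡b (sym (+-identityʳ b))))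
    ... | inj₂ (j , refl) =
      <⇒≢ (proj₂ (after-first-block-< _ (s≤s (s≤s (m≤m+n e j))) (≤-trans (<⇒≤ q<y) y≤n))) σq≡b

    no-last : NoPatternThroughLast
    no-last x y 1≤x x<y y≤n σ′x<b b<σ′y with position-view x 1≤x
    ... | inj₁ (j , j≤e , refl) with σ′-view x 1≤x (≤-trans (<⇒≤ x<y) y≤n)
    ...   | fixed _ σ′x≡σx = <⇒≱ σ′x<b (subst (b ≤_) (sym σ′x≡σx) (first-block-≥ x 1≤x (s≤s j≤e)))
    ...   | swapped _ σ′x≡1+n = <⇒≱ σ′x<b (subst (b ≤_) (sym σ′x≡1+n) (m≤n⇒m≤1+n b≤n))
    no-last x y 1≤x x<y y≤n σ′x<b b<σ′y | inj₂ (j , refl) =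
      <⇒≱ b<σ′y (subst (_≤ b) (sym σ′y≡σy) (<⇒≤ σy<b))
      where
      σy<b : σ y < b
      σy<b = proj₂ (after-first-block-< y (<-trans (s≤s (s≤s (m≤m+n e j))) x<y) y≤n)
      σ′y≡σy : σ′ y ≡ σ y
      σ′y≡σy = σ′≡σ-below y (≤-trans 1≤x (<⇒≤ x<y)) y≤n σy<b

    first-block′ : ∀ j → j ≤ 0 → φ g′ (suc j) ≡ suc n + j
    first-block′ zero z≤n = trans φ-first (sym (+-identityʳ (suc n)))

    middle-block′ : ∀ j → suc (b + j) < suc n → φ g′ (suc (suc (0 + j))) ≡ suc (b + j)
    middle-block′ j 1+b+j<1+n = begin
      φ g′ (suc (suc j)) ≡⟨ unmoved (suc (suc j)) (s≤s z≤n) (1+j≤n (suc j) j<e) σ≢b ⟩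
      σ (suc (suc j))    ≡⟨ first-block (suc j) j<e ⟩
      b + suc j          ≡⟨ +-suc b j ⟩
      suc (b + j)        ∎
      where
      open ≡-Reasoning
      j<e : j < e
      j<e = +-cancelˡ-< b j e (subst (b + j <_) (sym b+e≡n) (≤-pred 1+b+j<1+n))
      σ≢b : σ (suc (suc j)) ≢ b
      σ≢b σ≡b = m≢1+m+n b (trans (sym σ≡b) (trans (first-block (suc j) j<e) (+-suc b j)))

    last-block′ : ∀ x → x ≤ suc n → suc n < x + b → 1 ≤ φ g′ x × φ g′ x ≤ b
    last-block′ x x≤1+n 1+n<x+b with m≤n⇒m<n∨m≡n x≤1+n
    ... | inj₂ refl = subst (λ t → 1 ≤ t × t ≤ b) (sym φ-new) (≤-trans 1≤a (<⇒≤ a<b) , ≤-refl)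
    ... | inj₁ (s≤s x≤n) = subst (λ t → 1 ≤ t × t ≤ b) (sym φx≡σx) (1≤σx , <⇒≤ σx<b)
      where
      1+e<x : suc e < x
      1+e<x = +-cancelˡ-< b (suc e) x (subst₂ _<_ (sym 1+b+e≡1+n) (+-comm x b) 1+n<x+b)
      σx-bounds : 1 ≤ σ x × σ x < b
      σx-bounds = after-first-block-< x 1+e<x x≤n
      1≤σx : 1 ≤ σ x
      1≤σx = proj₁ σx-bounds
      σx<b : σ x < b
      σx<b = proj₂ σx-bounds
      φx≡σx : φ g′ x ≡ σ x
      φx≡σx = unmoved x (≤-trans (s≤s z≤n) (<⇒≤ 1+e<x)) x≤n (<⇒≢ σx<b)

    shape : Shape (suc n) g′
    shape = record
      { a = b ; b = suc n ; e = 0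
      ; a≡ = at-new
      ; b≡ = φ-first
      ; b+e≡n = +-identityʳ (suc n)
      ; 1≤a = ≤-trans 1≤a (<⇒≤ a<b)
      ; a<b = s≤s b≤n
      ; first-block = first-block′
      ; middle-block = middle-block′
      ; last-block = last-block′
      ; one-before = one-before-kept
      ; a≡1⇒b≡2 = λ b≡1 → contradiction (sym b≡1) (<⇒≢ 2≤b)
      ; avoids = avoids′ no-top no-last
      }

  module AppendSucc (1+a<b : suc a < b) where
    open Append (suc a)

    1+a≤n : suc a ≤ n
    1+a≤n = <⇒≤ (<-≤-trans 1+a<b b≤n)

    no-top : NoPatternThroughTop
    no-top x q y 1≤x x<q q<y y≤n σq≡1+a σx<σy with position-view q (≤-trans 1≤x (<⇒≤ x<q))
    ... | inj₁ (j , j≤e , refl) = <⇒≱ 1+a<b (subst (b ≤_) σq≡1+a (first-block-≥ (suc j) (s≤s z≤n) (s≤s j≤e)))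
    ... | inj₂ (j , refl) with after-first-block j (≤-trans (<⇒≤ q<y) y≤n)
    ...   | last _ _ σq≤a = 1+n≰n (subst (_≤ a) σq≡1+a σq≤a)
    ...   | middle _ σq≡1+a+j = <⇒≱ (<-trans (≤-<-trans b≤σx σx<σy) σy<b) ≤-refl
      where
      j≡0 : j ≡ 0
      j≡0 = +-cancelˡ-≡ a j 0 (trans (suc-injective (trans (sym σq≡1+a+j) σq≡1+a)) (sym (+-identityʳ a)))
      b≤σx : b ≤ σ x
      b≤σx = first-block-≥ x 1≤x (≤-pred (subst (λ t → x < suc (suc t)) (trans (cong (e +_) j≡0) (+-identityʳ e)) x<q))
      σy<b : σ y < b
      σy<b = proj₂ (after-first-block-< y (<-trans (s≤s (s≤s (m≤m+n e j))) q<y) y≤n)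

    no-last : NoPatternThroughLast
    no-last x y 1≤x x<y y≤n σ′x<1+a 1+a<σ′y with position-view x 1≤x
    ... | inj₁ (j , j≤e , refl) = <⇒≱ a<b (≤-pred (≤-<-trans (first-block-≥ x 1≤x (s≤s j≤e)) σx<1+a))
      where σx<1+a = subst (_< suc a) (σ′≡σ x 1≤x (≤-trans (<⇒≤ x<y) y≤n) (<-≤-trans σ′x<1+a (m≤n⇒m≤1+n 1+a≤n))) σ′x<1+a
    ... | inj₂ (j , refl) with after-first-block j (≤-trans (<⇒≤ x<y) y≤n)
    ...   | middle _ σx≡1+a+j = <⇒≱ σx<1+a (subst (suc a ≤_) (sym σx≡1+a+j) (s≤s (m≤m+n a j)))
      where σx<1+a = subst (_< suc a) (σ′≡σ x 1≤x (≤-trans (<⇒≤ x<y) y≤n) (<-≤-trans σ′x<1+a (m≤n⇒m≤1+n 1+a≤n))) σ′x<1+a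
    ...   | last b≤1+a+j _ _ = <⇒≱ 1+a<σ′y (subst (_≤ suc a) (sym σ′y≡σy) (m≤n⇒m≤1+n σy≤a))
      where
      σy≤a : σ y ≤ a
      σy≤a = proj₂ (last-block y y≤n (<-≤-trans (past-middle j b≤1+a+j) (+-monoˡ-≤ a (<⇒≤ x<y))))
      σ′y≡σy : σ′ y ≡ σ y
      σ′y≡σy = σ′≡σ-below y (≤-trans 1≤x (<⇒≤ x<y)) y≤n (s≤s σy≤a)

    first-block′ : ∀ j → j ≤ suc e → φ g′ (suc j) ≡ b + j
    first-block′ j j≤1+e with m≤n⇒m<n∨m≡n j≤1+e
    ... | inj₁ (s≤s j≤e) = trans (unmoved (suc j) (s≤s z≤n) (1+j≤n j j≤e) σ≢1+a) (first-block j j≤e)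
      where
      σ≢1+a : σ (suc j) ≢ suc a
      σ≢1+a σ≡1+a = <⇒≱ 1+a<b (subst (b ≤_) (trans (sym (first-block j j≤e)) σ≡1+a) (m≤m+n b j))
    ... | inj₂ refl = begin
      φ g′ (suc (suc e))                ≡⟨ snoc (suc (suc e)) ⟩
      transp (suc n) (suc a) (σ (suc (suc e))) ≡⟨ cong (transp (suc n) (suc a)) σ≡1+a ⟩
      transp (suc n) (suc a) (suc a)    ≡⟨ transp-snd (suc n) (suc a) (<⇒≢ (s≤s 1+a≤n)) ⟩
      suc n                              ≡⟨ 1+b+e≡1+n ⟨
      b + suc e                          ∎
      where
      open ≡-Reasoning
      σ≡1+a : σ (suc (suc e)) ≡ suc a
      σ≡1+a = subst (λ t → σ (suc (suc t)) ≡ suc a) (+-identityʳ e)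
        (trans (middle-block 0 (subst (λ t → suc t < b) (sym (+-identityʳ a)) 1+a<b)) (cong suc (+-identityʳ a)))

    middle-block′ : ∀ j → suc (suc a + j) < b → φ g′ (suc (suc (suc e + j))) ≡ suc (suc a + j)
    middle-block′ j 2+a+j<b = begin
      φ g′ (suc (suc (suc e + j)))   ≡⟨ cong (λ t → φ g′ (suc (suc t))) (+-suc e j) ⟨
      φ g′ (suc (suc (e + suc j)))   ≡⟨ unmoved _ (s≤s z≤n) (2+e+j≤n (suc j) in-middle) σ≢1+a ⟩
      σ (suc (suc (e + suc j)))      ≡⟨ middle-block (suc j) in-middle ⟩
      suc (a + suc j)                ≡⟨ cong suc (+-suc a j) ⟩
      suc (suc a + j)                ∎
      where
      open ≡-Reasoning
      in-middle : suc (a + suc j) < b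
      in-middle = subst (λ t → suc t < b) (sym (+-suc a j)) 2+a+j<b
      σ≢1+a : σ (suc (suc (e + suc j))) ≢ suc a
      σ≢1+a σ≡1+a = m≢1+m+n a (trans (suc-injective (trans (sym σ≡1+a) (middle-block (suc j) in-middle))) (+-suc a j))

    last-block′ : ∀ x → x ≤ suc n → suc n < x + suc a → 1 ≤ φ g′ x × φ g′ x ≤ suc a
    last-block′ x x≤1+n 1+n<x+1+a with m≤n⇒m<n∨m≡n x≤1+n
    ... | inj₂ refl = subst (λ t → 1 ≤ t × t ≤ suc a) (sym φ-new) (s≤s z≤n , ≤-refl)
    ... | inj₁ (s≤s x≤n) = subst (λ t → 1 ≤ t × t ≤ suc a) (sym φx≡σx) (1≤σx , m≤n⇒m≤1+n σx≤a)
      where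
      n<x+a : n < x + a
      n<x+a = ≤-pred (subst (suc n <_) (+-suc x a) 1+n<x+1+a)
      σx-bounds : 1 ≤ σ x × σ x ≤ a
      σx-bounds = last-block x x≤n n<x+a
      1≤σx : 1 ≤ σ x
      1≤σx = proj₁ σx-bounds
      σx≤a : σ x ≤ a
      σx≤a = proj₂ σx-bounds
      positive : ∀ x → n < x + a → 1 ≤ x
      positive zero n<a = contradiction n<a (<-asym a<n)
      positive (suc _) _ = s≤s z≤n
      1≤x : 1 ≤ x
      1≤x = positive x n<x+a
      φx≡σx : φ g′ x ≡ σ x
      φx≡σx = unmoved x 1≤x x≤n (<⇒≢ (s≤s σx≤a))

    shape : Shape (suc n) g′
    shape = record
      { a = suc a ; b = b ; e = suc e
      ; a≡ = at-new
      ; b≡ = trans (unmoved 1 ≤-refl 1≤n λ σ1≡1+a → <⇒≢ 1+a<b (trans (sym σ1≡1+a) b≡)) b≡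
      ; b+e≡n = 1+b+e≡1+n
      ; 1≤a = s≤s z≤n
      ; a<b = 1+a<b
      ; first-block = first-block′
      ; middle-block = middle-block′
      ; last-block = last-block′
      ; one-before = one-before-kept
      ; a≡1⇒b≡2 = λ 1+a≡1 → contradiction (suc-injective 1+a≡1) (<⇒≢ 1≤a ∘ sym)
      ; avoids = avoids′ no-top no-last
      }

  module AppendOne (a≡1 : a ≡ 1) where
    open Append 1

    b≡2 : b ≡ 2
    b≡2 = a≡1⇒b≡2 a≡1

    2+e≡n : suc (suc e) ≡ n
    2+e≡n = trans (cong (_+ e) (sym b≡2)) b+e≡n

    no-top : NoPatternThroughTop
    no-top x q y 1≤x x<q q<y y≤n σq≡1 _ with position-view q (≤-trans 1≤x (<⇒≤ x<q))
    ... | inj₁ (j , j≤e , refl) = <⇒≱ 2≤b (subst (b ≤_) σq≡1 (first-block-≥ (suc j) (s≤s z≤n) (s≤s j≤e)))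
    ... | inj₂ (j , refl) = <⇒≱ q<y (≤-trans y≤n (subst (_≤ suc (suc (e + j))) 2+e≡n (s≤s (s≤s (m≤m+n e j)))))

    no-last : NoPatternThroughLast
    no-last x y 1≤x x<y y≤n σ′x<1 _ with σ′-view x 1≤x (≤-trans (<⇒≤ x<y) y≤n)
    ... | fixed _ σ′x≡σx = <⇒≱ σ′x<1 (subst (1 ≤_) (sym σ′x≡σx) (1≤σ x 1≤x (≤-trans (<⇒≤ x<y) y≤n)))
    ... | swapped _ σ′x≡1+n = <⇒≱ σ′x<1 (subst (1 ≤_) (sym σ′x≡1+n) (s≤s z≤n))

    first-block′ : ∀ j → j ≤ suc e → φ g′ (suc j) ≡ b + j
    first-block′ j j≤1+e with m≤n⇒m<n∨m≡n j≤1+e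
    ... | inj₁ (s≤s j≤e) = trans (unmoved (suc j) (s≤s z≤n) (1+j≤n j j≤e) σ≢1) (first-block j j≤e)
      where
      σ≢1 : σ (suc j) ≢ 1
      σ≢1 σ≡1 = <⇒≱ 2≤b (subst (b ≤_) (trans (sym (first-block j j≤e)) σ≡1) (m≤m+n b j))
    ... | inj₂ refl = begin
      φ g′ (suc (suc e))          ≡⟨ snoc (suc (suc e)) ⟩
      transp (suc n) 1 (σ (suc (suc e))) ≡⟨ cong (transp (suc n) 1) (trans (cong σ 2+e≡n) (trans σn≡a a≡1)) ⟩
      transp (suc n) 1 1          ≡⟨ transp-snd (suc n) 1 (<⇒≢ (s≤s 1≤n)) ⟩
      suc n                        ≡⟨ 1+b+e≡1+n ⟨
      b + suc e                    ∎
      where open ≡-Reasoning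

    last-block′ : ∀ x → x ≤ suc n → suc n < x + 1 → 1 ≤ φ g′ x × φ g′ x ≤ 1
    last-block′ x x≤1+n 1+n<x+1 = subst (λ t → 1 ≤ φ g′ t × φ g′ t ≤ 1) (sym x≡1+n)
      (subst (λ t → 1 ≤ t × t ≤ 1) (sym φ-new) (≤-refl , ≤-refl))
      where
      x≡1+n : x ≡ suc n
      x≡1+n = ≤-antisym x≤1+n (≤-pred (subst (suc n <_) (+-comm x 1) 1+n<x+1))

    shape : Shape (suc n) g′
    shape = record
      { a = 1 ; b = b ; e = suc e
      ; a≡ = at-new
      ; b≡ = trans (unmoved 1 ≤-refl 1≤n λ σ1≡1 → <⇒≢ 2≤b (trans (sym σ1≡1) b≡)) b≡
      ; b+e≡n = 1+b+e≡1+n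
      ; 1≤a = ≤-refl
      ; a<b = 2≤b
      ; first-block = first-block′
      ; middle-block = λ j 2+j<b → contradiction (subst (suc (suc j) <_) b≡2 2+j<b) λ { (s≤s (s≤s ())) }
      ; last-block = last-block′
      ; one-before = λ 2≤1 → contradiction 2≤1 λ { (s≤s ()) }
      ; a≡1⇒b≡2 = λ _ → b≡2
      ; avoids = avoids′ no-top no-last
      }

  -- Such a v already occurs in φ(f) after a smaller value: after φ(f)(1) = b in
  -- the first block, after a + 1 in the middle block, or (v = a) after the 1
  -- preceding position n. With the new last position this is an obstruction.
  obstruction-otherwise : ∀ v → a ≤ v → v ≤ n → v ≢ suc a → v ≢ b → ¬ (v ≡ 1 × a ≡ 1) →
    Obstruction (suc n) (φ (f ++ [ v ])) (at (f ++ [ v ]) (suc n))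
  obstruction-otherwise v a≤v v≤n v≢1+a v≢b ¬v≡1≡a = obstruction′ (by-cases (m≤n⇒m<n∨m≡n a≤v) (<-cmp b v))
    where
    open Append v
    by-cases : a < v ⊎ a ≡ v → Tri (b < v) (b ≡ v) (v < b) → Obstruction (suc n) σ′ v
    by-cases (inj₂ refl) _ with 2 ≤? a
    ... | no 2≰a = contradiction (≱2⇒a≡1 2≰a , ≱2⇒a≡1 2≰a) ¬v≡1≡a
    ... | yes 2≤a with one-before 2≤a
    ...   | x , 1≤x , x<n , σx≡1 =
      obstruction-through-last x n 1≤x x<n ≤-refl σn≡a (subst (_< a) (sym σx≡1) 2≤a) v≤n
    by-cases (inj₁ _) (tri≈ _ b≡v _) = contradiction (sym b≡v) v≢b
    by-cases (inj₁ _) (tri< b<v _ _) with m≤n⇒∃[o]m+o≡n b<v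
    ... | k , refl = obstruction-through-last 1 (suc (suc k)) ≤-refl (s≤s (s≤s z≤n)) (1+j≤n (suc k) 1+k≤e)
                       (trans (first-block (suc k) 1+k≤e) (+-suc b k)) (subst (_< v) (sym b≡) b<v) v≤n
      where
      1+k≤e : suc k ≤ e
      1+k≤e = +-cancelˡ-≤ b (suc k) e (subst₂ _≤_ (sym (+-suc b k)) (sym b+e≡n) v≤n)
    by-cases (inj₁ a<v) (tri> _ _ v<b) with m≤n⇒∃[o]m+o≡n a<v
    ... | zero , refl = contradiction (cong suc (+-identityʳ a)) v≢1+a
    ... | suc k , refl = obstruction-through-last (suc (suc (e + 0))) (suc (suc (e + suc k))) (s≤s z≤n)
                           (s≤s (s≤s (+-monoʳ-< e z<s))) (2+e+j≤n (suc k) v<b) (middle-block (suc k) v<b)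
                           (subst (_< v) (sym (middle-block 0 1+a+0<b)) 1+a+0<v) v≤n
      where
      1+a+0<v : suc (a + 0) < suc (a + suc k)
      1+a+0<v = s≤s (+-monoʳ-< a z<s)
      1+a+0<b : suc (a + 0) < b
      1+a+0<b = <-trans 1+a+0<v v<b

  data Growth (v : ℕ) : Set where
    grows : admissible a b v ≡ true → Shape (suc n) (f ++ [ v ]) → Growth v
    dies  : admissible a b v ≡ false → Obstruction (suc n) (φ (f ++ [ v ])) (at (f ++ [ v ]) (suc n)) → Growth v

  grow : ∀ v → a ≤ v → v ≤ n → Growth v
  grow v a≤v v≤n with v ≟ suc a | v ≟ b
  ... | yes refl | _ = grows (admissible-succ a b) succ-shape
    where
    succ-shape : Shape (suc n) (f ++ [ suc a ])
    succ-shape with suc a ≟ b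
    ... | yes 1+a≡b = subst (λ t → Shape (suc n) (f ++ [ t ])) (sym 1+a≡b) AppendHead.shape
    ... | no 1+a≢b = AppendSucc.shape (≤∧≢⇒< a<b 1+a≢b)
  ... | no _ | yes refl = grows (admissible-head a b) AppendHead.shape
  ... | no v≢1+a | no v≢b with (v ≟ 1) ×-dec (a ≟ 1)
  ...   | yes (refl , a≡1) = grows (admissible-one b a≡1) (AppendOne.shape a≡1)
  ...   | no ¬v≡1≡a = dies (admissible-false v≢1+a v≢b ¬v≡1≡a) (obstruction-otherwise v a≤v v≤n v≢1+a v≢b ¬v≡1≡a)

  admissible-snoc : ∀ v → v ≤ suc n →
    (a ≤ᵇ v) ∧ (not (v ≡ᵇ suc n) ∧ avoids132 (suc n) (φ (f ++ [ v ]))) ≡ admissible a b v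
  admissible-snoc v v≤1+n with v <? a
  ... | yes v<a rewrite ≤ᵇ-false v<a =
    sym (admissible-false (<⇒≢ (m<n⇒m<1+n v<a)) (<⇒≢ (<-trans v<a a<b)) λ (v≡1 , a≡1) → <⇒≢ v<a (trans v≡1 (sym a≡1)))
  ... | no v≮a with m≤n⇒m<n∨m≡n v≤1+n
  ...   | inj₂ refl rewrite ≡ᵇ-refl (suc n) =
    trans (∧-zeroʳ (a ≤ᵇ suc n))
      (sym (admissible-false (<⇒≢ (s≤s a<n) ∘ sym) (<⇒≢ (s≤s b≤n) ∘ sym) λ (1+n≡1 , _) → <⇒≢ 1≤n (sym (suc-injective 1+n≡1))))
  ...   | inj₁ (s≤s v≤n) rewrite ≤ᵇ-true (≮⇒≥ v≮a) | ≡ᵇ-false (<⇒≢ (s≤s v≤n)) with grow v (≮⇒≥ v≮a) v≤n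
  ...     | grows adm J′ rewrite avoids132-true _ _ (Shape.avoids J′) = sym adm
  ...     | dies adm O rewrite avoids132-false _ _ (proj₁ O) = sym adm

shape-11 : Shape 2 (1 ∷ 1 ∷ [])
shape-11 = record
  { a = 1 ; b = 2 ; e = 0 ; a≡ = refl ; b≡ = refl ; b+e≡n = refl ; 1≤a = ≤-refl ; a<b = ≤-refl
  ; first-block = λ { zero _ → refl }
  ; middle-block = λ { _ (s≤s (s≤s ())) }
  ; last-block = last
  ; one-before = λ { (s≤s ()) }
  ; a≡1⇒b≡2 = λ _ → refl
  ; avoids = λ p → contradiction (Pattern132-length≥3 p) λ { (s≤s (s≤s ())) }
  }
  where
  last : ∀ x → x ≤ 2 → 2 < x + 1 → 1 ≤ φ (1 ∷ 1 ∷ []) x × φ (1 ∷ 1 ∷ []) x ≤ 1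
  last (suc (suc zero)) _ _ = ≤-refl , ≤-refl
  last (suc (suc (suc _))) (s≤s (s≤s ())) _
  last (suc zero) _ (s≤s (s≤s ()))
  last zero _ (s≤s ())

shape-or-obstruction : ∀ m g → g ∈ subexceedant (suc (suc m)) →
  nondecreasing (suc (suc m)) g ≡ true → noFixedPointAbove1 (suc (suc m)) g ≡ true →
  Shape (suc (suc m)) g ⊎ Obstruction (suc (suc m)) (φ g) (at g (suc (suc m)))
shape-or-obstruction zero .(1 ∷ 1 ∷ []) (here refl) _ _ = inj₁ shape-11
shape-or-obstruction zero .(1 ∷ 2 ∷ []) (there (here refl)) _ ()
shape-or-obstruction (suc m) g g∈ nondec no-fix with ∈-subexceedant-suc⁻ {suc (suc m)} g∈
... | h , v , h∈ , v∈ , refl = extend (shape-or-obstruction m h h∈ (∧-conicalˡ _ _ nondec′) (∧-conicalˡ _ _ no-fix′))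
  where
  S : SubexceedantWord (suc (suc m)) h
  S = subexceedantWord _ h h∈
  open Snoc (suc m) h v (length≡ S)
  nondec′ : nondecreasing (suc (suc m)) h ∧ (at h (suc (suc m)) ≤ᵇ v) ≡ true
  nondec′ = trans (sym nondecreasing-snoc) nondec
  no-fix′ : noFixedPointAbove1 (suc (suc m)) h ∧ not (v ≡ᵇ suc (suc (suc m))) ≡ true
  no-fix′ = trans (sym noFixedPointAbove1-snoc) no-fix
  hn≤v : at h (suc (suc m)) ≤ v
  hn≤v = ≤ᵇ⇒≤ _ _ (≡-true⇒T (∧-conicalʳ _ _ nondec′))
  v≤n : v ≤ suc (suc m)
  v≤n with m≤n⇒m<n∨m≡n (proj₂ (∈-upto⁻ v∈))
  ... | inj₁ (s≤s v≤n) = v≤n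
  ... | inj₂ refl = contradiction (trans (cong not (sym (≡ᵇ-refl v))) (∧-conicalʳ _ _ no-fix′)) λ ()
  extend : Shape (suc (suc m)) h ⊎ Obstruction (suc (suc m)) (φ h) (at h (suc (suc m))) →
    Shape (suc (suc (suc m))) g′ ⊎ Obstruction (suc (suc (suc m))) (φ g′) (at g′ (suc (suc (suc m))))
  extend (inj₂ O) = inj₂ (obstruction-persists S O hn≤v)
  extend (inj₁ J) with Grow.grow J S v (subst (_≤ v) (Shape.a≡ J) hn≤v) v≤n
  ... | Grow.grows _ J′ = inj₁ J′
  ... | Grow.dies _ O = inj₂ O

good : ℕ → List ℕ → Bool
good n f = nondecreasing n f ∧ (noFixedPointAbove1 n f ∧ avoids132 n (φ f))

module _ (m : ℕ) {g : List ℕ} (g∈ : g ∈ subexceedant (suc (suc m))) where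
  private
    n : ℕ
    n = suc (suc m)
    S : SubexceedantWord n g
    S = subexceedantWord n g g∈

  good-snoc : ∀ v → v ≤ suc n → good (suc n) (g ++ [ v ]) ≡ good n g ∧ admissible (at g n) (φ g 1) v
  good-snoc v v≤1+n
    rewrite Snoc.nondecreasing-snoc (suc m) g v (length≡ S) | Snoc.noFixedPointAbove1-snoc (suc m) g v (length≡ S)
    with nondecreasing n g in nondec | noFixedPointAbove1 n g in no-fix
  ... | false | _ = refl
  ... | true | false = ∧-zeroʳ _
  ... | true | true with shape-or-obstruction m g g∈ nondec no-fix
  ...   | inj₁ J rewrite avoids132-true n (φ g) (Shape.avoids J) | Shape.a≡ J | Shape.b≡ J = Grow.admissible-snoc J S v v≤1+n
  ...   | inj₂ O rewrite avoids132-false n (φ g) (proj₁ O) with v <? at g n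
  ...     | yes v<gn rewrite ≤ᵇ-false v<gn = refl
  ...     | no v≮gn rewrite avoids132-false (suc n) (φ (g ++ [ v ])) (proj₁ (obstruction-persists S O (≮⇒≥ v≮gn))) =
    trans (cong ((at g n ≤ᵇ v) ∧_) (∧-zeroʳ (not (v ≡ᵇ suc n)))) (∧-zeroʳ (at g n ≤ᵇ v))

transfer : ℕ → (Summary → ℕ) → Summary → ℕ
transfer n F s = sum (map (λ v → if admissible (Summary.last s) (Summary.head s) v then F (advance n s v) else 0) (upto (suc n)))

weighted : ℕ → (Summary → ℕ) → ℕ
weighted n F = sum (map (λ f → if good n f then F (summarise n f) else 0) (subexceedant n))

sum-map-if-∧ : ∀ {A : Set} b (p : A → Bool) (h : A → ℕ) xs →
  sum (map (λ x → if b ∧ p x then h x else 0) xs) ≡ (if b then sum (map (λ x → if p x then h x else 0) xs) else 0)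
sum-map-if-∧ true p h xs = refl
sum-map-if-∧ false p h [] = refl
sum-map-if-∧ false p h (x ∷ xs) = sum-map-if-∧ false p h xs

weighted-suc : ∀ m F → weighted (suc (suc (suc m))) F ≡ weighted (suc (suc m)) (transfer (suc (suc m)) F)
weighted-suc m F = begin
  sum (map w (concatMap (λ g → map (λ v → g ++ [ v ]) (upto (suc n))) (subexceedant n)))
    ≡⟨ sum-concatMap w (λ g → map (λ v → g ++ [ v ]) (upto (suc n))) (subexceedant n) ⟩
  sum (map (λ g → sum (map w (map (λ v → g ++ [ v ]) (upto (suc n))))) (subexceedant n))
    ≡⟨ sum-cong-∈ _ _ (subexceedant n) extensions ⟩
  sum (map (λ g → if good n g then transfer n F (summarise n g) else 0) (subexceedant n)) ∎
  where
  open ≡-Reasoning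
  n : ℕ
  n = suc (suc m)
  w : List ℕ → ℕ
  w f = if good (suc n) f then F (summarise (suc n) f) else 0
  extensions : ∀ {g} → g ∈ subexceedant n →
    sum (map w (map (λ v → g ++ [ v ]) (upto (suc n)))) ≡ (if good n g then transfer n F (summarise n g) else 0)
  extensions {g} g∈ = begin
    sum (map w (map (λ v → g ++ [ v ]) (upto (suc n))))   ≡⟨ cong sum (map-∘ {g = w} {f = λ v → g ++ [ v ]} (upto (suc n))) ⟨
    sum (map (λ v → w (g ++ [ v ])) (upto (suc n)))
      ≡⟨ sum-cong-∈ _ _ (upto (suc n)) (λ v∈ → cong₂ (λ c s → if c then F s else 0)
           (good-snoc m g∈ _ (proj₂ (∈-upto⁻ v∈))) (Snoc.summarise-snoc (suc m) g _ (length≡ (subexceedantWord n g g∈)))) ⟩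
    sum (map (λ v → if good n g ∧ admissible (at g n) (φ g 1) v then F (advance n (summarise n g) v) else 0) (upto (suc n)))
      ≡⟨ sum-map-if-∧ (good n g) _ _ (upto (suc n)) ⟩
    (if good n g then transfer n F (summarise n g) else 0) ∎

transfer-power : ℕ → ℕ → (Summary → ℕ) → Summary → ℕ
transfer-power i zero F = F
transfer-power i (suc r) F = transfer i (transfer-power (suc i) r F)

weighted-+ : ∀ r m F → weighted (suc (suc m) + r) F ≡ weighted (suc (suc m)) (transfer-power (suc (suc m)) r F)
weighted-+ zero m F = cong (λ t → weighted t F) (+-identityʳ (suc (suc m)))
weighted-+ (suc r) m F = begin
  weighted (suc (suc m) + suc r) F                                      ≡⟨ cong (λ t → weighted t F) (+-suc (suc (suc m)) r) ⟩
  weighted (suc (suc (suc m)) + r) F                                    ≡⟨ weighted-+ r (suc m) F ⟩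
  weighted (suc (suc (suc m))) (transfer-power (suc (suc (suc m))) r F) ≡⟨ weighted-suc m (transfer-power (suc (suc (suc m))) r F) ⟩
  weighted (suc (suc m)) (transfer-power (suc (suc m)) (suc r) F)       ∎
  where open ≡-Reasoning

plateau-indicator : ℕ → Summary → ℕ
plateau-indicator k s = if Summary.plateaus s ≡ᵇ k then 1 else 0

d≡weighted : ∀ n k → d n k ≡ weighted n (plateau-indicator k)
d≡weighted n k = trans (length-filterᵇ _ (subexceedant n)) (sum-cong-∈ _ _ (subexceedant n) λ {f} _ →
  split (nondecreasing n f) (noFixedPointAbove1 n f) (plateaus1 n f ≡ᵇ k) (avoids132 n (φ f)))
  where
  split : ∀ p q r s → (if p ∧ q ∧ r ∧ s then 1 else 0) ≡ (if p ∧ q ∧ s then (if r then 1 else 0) else 0)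
  split false _ _ _ = refl
  split true false _ _ = refl
  split true true false true = refl
  split true true true true = refl
  split true true false false = refl
  split true true true false = refl

-- The only good word of length 2 is 11, whose summary is (1, 2, 1).
d≡transfer-power : ∀ r k → d (suc (suc r)) k ≡ transfer-power 2 r (plateau-indicator k) (summary 1 2 1)
d≡transfer-power r k = begin
  d (2 + r) k                                                   ≡⟨ d≡weighted (2 + r) k ⟩
  weighted (2 + r) (plateau-indicator k)                        ≡⟨ weighted-+ r 0 (plateau-indicator k) ⟩
  weighted 2 (transfer-power 2 r (plateau-indicator k))         ≡⟨ +-identityʳ _ ⟩
  transfer-power 2 r (plateau-indicator k) (summary 1 2 1)      ∎
  where open ≡-Reasoning

admissible-≥2 : ∀ {a} b v → 2 ≤ a → admissible a b v ≡ (v ≡ᵇ suc a) ∨ (v ≡ᵇ b)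
admissible-≥2 b v 2≤a rewrite ≡ᵇ-false (<⇒≢ 2≤a ∘ sym) | ∧-zeroʳ (v ≡ᵇ 1) = cong ((v ≡ᵇ suc _) ∨_) (∨-identityʳ (v ≡ᵇ b))

if-∨-disjoint : ∀ {x y} (k : ℕ) → ¬ (T x × T y) → (if x ∨ y then k else 0) ≡ (if x then k else 0) + (if y then k else 0)
if-∨-disjoint {true} {true} k disjoint = contradiction (tt , tt) disjoint
if-∨-disjoint {true} {false} k _ = sym (+-identityʳ k)
if-∨-disjoint {false} k _ = refl

sum-upto-indicator : ∀ (G : ℕ → ℕ) c n → 1 ≤ c → c ≤ n → sum (map (λ v → if v ≡ᵇ c then G v else 0) (upto n)) ≡ G c
sum-upto-indicator G c n 1≤c c≤n = sum-range-indicator G c 1 n 1≤c (s≤s c≤n)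

transfer-gap : ∀ n F a b p → 2 ≤ a → suc a < b → b ≤ n →
  transfer n F (summary a b p) ≡ F (summary (suc a) b p) + F (summary b (suc n) p)
transfer-gap n F a b p 2≤a 1+a<b b≤n = begin
  sum (map (λ v → if admissible a b v then K v else 0) (upto (suc n)))
    ≡⟨ sum-cong-∈ _ _ (upto (suc n)) (λ {v} _ → trans (cong (λ c → if c then K v else 0) (admissible-≥2 b v 2≤a))
                                                    (if-∨-disjoint (K v) (disjoint v))) ⟩
  sum (map (λ v → (if v ≡ᵇ suc a then K v else 0) + (if v ≡ᵇ b then K v else 0)) (upto (suc n)))
    ≡⟨ sum-map-+ (λ v → if v ≡ᵇ suc a then K v else 0) (λ v → if v ≡ᵇ b then K v else 0) (upto (suc n)) ⟩
  sum (map (λ v → if v ≡ᵇ suc a then K v else 0) (upto (suc n))) + sum (map (λ v → if v ≡ᵇ b then K v else 0) (upto (suc n)))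
    ≡⟨ cong₂ _+_ (sum-upto-indicator K (suc a) (suc n) (s≤s z≤n) (<⇒≤ (<-≤-trans 1+a<b (m≤n⇒m≤1+n b≤n))))
                 (sum-upto-indicator K b (suc n) (≤-trans (s≤s z≤n) (<⇒≤ 1+a<b)) (m≤n⇒m≤1+n b≤n)) ⟩
  K (suc a) + K b
    ≡⟨ cong₂ (λ s t → F s + F t) (cong₂ (summary (suc a)) stay (no-plateau (suc a))) (cong₂ (summary b) (transp-snd (suc n) b (<⇒≢ (s≤s b≤n))) (no-plateau b)) ⟩
  F (summary (suc a) b p) + F (summary b (suc n) p) ∎
  where
  open ≡-Reasoning
  K : ℕ → ℕ
  K v = F (advance n (summary a b p) v)
  disjoint : ∀ v → ¬ (T (v ≡ᵇ suc a) × T (v ≡ᵇ b))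
  disjoint v (v≡1+a , v≡b) = <⇒≢ 1+a<b (trans (sym (≡ᵇ⇒≡ v _ v≡1+a)) (≡ᵇ⇒≡ v b v≡b))
  stay : transp (suc n) (suc a) b ≡ b
  stay = transp-other (suc n) (suc a) b (<⇒≢ (s≤s b≤n)) (>⇒≢ 1+a<b)
  no-plateau : ∀ v → p + (if (a ≡ᵇ 1) ∧ (v ≡ᵇ 1) then 1 else 0) ≡ p
  no-plateau v rewrite ≡ᵇ-false (<⇒≢ 2≤a ∘ sym) = +-identityʳ p

transfer-adjacent : ∀ n F a p → 2 ≤ a → suc a ≤ n → transfer n F (summary a (suc a) p) ≡ F (summary (suc a) (suc n) p)
transfer-adjacent n F a p 2≤a 1+a≤n = begin
  sum (map (λ v → if admissible a (suc a) v then K v else 0) (upto (suc n)))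
    ≡⟨ sum-cong-∈ _ _ (upto (suc n)) (λ {v} _ → cong (λ c → if c then K v else 0)
                                                     (trans (admissible-≥2 (suc a) v 2≤a) (∨-idem (v ≡ᵇ suc a)))) ⟩
  sum (map (λ v → if v ≡ᵇ suc a then K v else 0) (upto (suc n)))
    ≡⟨ sum-upto-indicator K (suc a) (suc n) (s≤s z≤n) (m≤n⇒m≤1+n 1+a≤n) ⟩
  K (suc a)
    ≡⟨ cong F (cong₂ (summary (suc a)) (transp-snd (suc n) (suc a) (<⇒≢ (s≤s 1+a≤n))) no-plateau) ⟩
  F (summary (suc a) (suc n) p) ∎
  where
  open ≡-Reasoning
  K : ℕ → ℕ
  K v = F (advance n (summary a (suc a) p) v)
  no-plateau : p + (if (a ≡ᵇ 1) ∧ (suc a ≡ᵇ 1) then 1 else 0) ≡ p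
  no-plateau rewrite ≡ᵇ-false (<⇒≢ 2≤a ∘ sym) = +-identityʳ p

transfer-ones : ∀ n F p → 2 ≤ n → transfer n F (summary 1 2 p) ≡ F (summary 1 2 (suc p)) + F (summary 2 (suc n) p)
transfer-ones n F p 2≤n = begin
  sum (map (λ v → if admissible 1 2 v then K v else 0) (upto (suc n)))
    ≡⟨ sum-cong-∈ _ _ (upto (suc n)) (λ {v} _ → split v) ⟩
  sum (map (λ v → (if v ≡ᵇ 1 then K v else 0) + (if v ≡ᵇ 2 then K v else 0)) (upto (suc n)))
    ≡⟨ sum-map-+ (λ v → if v ≡ᵇ 1 then K v else 0) (λ v → if v ≡ᵇ 2 then K v else 0) (upto (suc n)) ⟩
  sum (map (λ v → if v ≡ᵇ 1 then K v else 0) (upto (suc n))) + sum (map (λ v → if v ≡ᵇ 2 then K v else 0) (upto (suc n)))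
    ≡⟨ cong₂ _+_ (sum-upto-indicator K 1 (suc n) ≤-refl (s≤s z≤n)) (sum-upto-indicator K 2 (suc n) (s≤s z≤n) (m≤n⇒m≤1+n 2≤n)) ⟩
  K 1 + K 2
    ≡⟨ cong₂ (λ s t → F s + F t) (cong₂ (summary 1) stay (+-comm p 1))
                                 (cong₂ (summary 2) (transp-snd (suc n) 2 (<⇒≢ (s≤s 2≤n))) (+-identityʳ p)) ⟩
  F (summary 1 2 (suc p)) + F (summary 2 (suc n) p) ∎
  where
  open ≡-Reasoning
  K : ℕ → ℕ
  K v = F (advance n (summary 1 2 p) v)
  split : ∀ v → (if admissible 1 2 v then K v else 0) ≡ (if v ≡ᵇ 1 then K v else 0) + (if v ≡ᵇ 2 then K v else 0)
  split zero = refl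
  split (suc zero) = sym (+-identityʳ (K 1))
  split (suc (suc zero)) = refl
  split (suc (suc (suc v))) = refl
  stay : transp (suc n) 1 2 ≡ 2
  stay = transp-other (suc n) 1 2 (<⇒≢ (s≤s 2≤n)) λ ()

-- walks r d e is the number of admissible continuations of length r of a
-- summary with head = last + d + 1 and n = head + e.
walks : ℕ → ℕ → ℕ → ℕ
walks zero d e = 1
walks (suc r) zero e = walks r e 0
walks (suc r) (suc d) e = walks r d (suc e) + walks r e 0

plateauWalks : ℕ → ℕ → ℕ → ℕ
plateauWalks k zero p = if suc p ≡ᵇ k then 1 else 0
plateauWalks k (suc r) p = plateauWalks k r (suc p) + (if suc p ≡ᵇ k then walks r p 0 else 0)

transfer-power-gap : ∀ k r a d e p i → 2 ≤ a → i ≡ a + suc d + e →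
  transfer-power i r (plateau-indicator k) (summary a (a + suc d) p) ≡ (if p ≡ᵇ k then walks r d e else 0)
transfer-power-gap k zero a d e p i _ _ = refl
transfer-power-gap k (suc r) a zero e p i 2≤a i≡ = begin
  transfer i F (summary a (a + 1) p)          ≡⟨ cong (λ t → transfer i F (summary a t p)) (+-comm a 1) ⟩
  transfer i F (summary a (suc a) p)          ≡⟨ transfer-adjacent i F a p 2≤a 1+a≤i ⟩
  F (summary (suc a) (suc i) p)               ≡⟨ cong (λ t → F (summary (suc a) t p)) i+1≡ ⟩
  F (summary (suc a) (suc a + suc e) p)       ≡⟨ transfer-power-gap k r (suc a) e 0 p (suc i) (m≤n⇒m≤1+n 2≤a) (trans i+1≡ (sym (+-identityʳ _))) ⟩
  (if p ≡ᵇ k then walks r e 0 else 0)         ∎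
  where
  open ≡-Reasoning
  F : Summary → ℕ
  F = transfer-power (suc i) r (plateau-indicator k)
  1+a≤i : suc a ≤ i
  1+a≤i = subst (suc a ≤_) (sym i≡) (subst (_≤ a + 1 + e) (+-comm a 1) (m≤m+n (a + 1) e))
  i+1≡ : suc i ≡ suc a + suc e
  i+1≡ = trans (cong suc i≡) (cong suc (trans (cong (_+ e) (+-comm a 1)) (sym (+-suc a e))))
transfer-power-gap k (suc r) a (suc d) e p i 2≤a i≡ = begin
  transfer i F (summary a b p)
    ≡⟨ transfer-gap i F a b p 2≤a 1+a<b b≤i ⟩
  F (summary (suc a) b p) + F (summary b (suc i) p)
    ≡⟨ cong₂ _+_ (cong (λ t → F (summary (suc a) t p)) (+-suc a (suc d))) (cong (λ t → F (summary b t p)) i+1≡) ⟩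
  F (summary (suc a) (suc a + suc d) p) + F (summary b (b + suc e) p)
    ≡⟨ cong₂ _+_ (transfer-power-gap k r (suc a) d (suc e) p (suc i) (m≤n⇒m≤1+n 2≤a) (trans i+1≡ (cong (_+ suc e) (+-suc a (suc d)))))
                 (transfer-power-gap k r b e 0 p (suc i) (≤-trans 2≤a (m≤m+n a (suc (suc d)))) (trans i+1≡ (sym (+-identityʳ _)))) ⟩
  (if p ≡ᵇ k then walks r d (suc e) else 0) + (if p ≡ᵇ k then walks r e 0 else 0)
    ≡⟨ if-+ (p ≡ᵇ k) ⟩
  (if p ≡ᵇ k then walks r d (suc e) + walks r e 0 else 0) ∎
  where
  open ≡-Reasoning
  F : Summary → ℕ
  F = transfer-power (suc i) r (plateau-indicator k)
  b : ℕ
  b = a + suc (suc d)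
  1+a<b : suc a < b
  1+a<b = ≤-trans (s≤s (s≤s (m≤m+n a d))) (≤-reflexive (sym (trans (+-suc a (suc d)) (cong suc (+-suc a d)))))
  b≤i : b ≤ i
  b≤i = subst (b ≤_) (sym i≡) (m≤m+n b e)
  i+1≡ : suc i ≡ b + suc e
  i+1≡ = trans (cong suc i≡) (sym (+-suc b e))
  if-+ : ∀ c {x y} → (if c then x else 0) + (if c then y else 0) ≡ (if c then x + y else 0)
  if-+ true = refl
  if-+ false = refl

transfer-power-ones : ∀ k r p → transfer-power (suc (suc p)) r (plateau-indicator k) (summary 1 2 (suc p)) ≡ plateauWalks k r p
transfer-power-ones k zero p = refl
transfer-power-ones k (suc r) p = begin
  transfer (2 + p) F (summary 1 2 (suc p))
    ≡⟨ transfer-ones (2 + p) F (suc p) (s≤s (s≤s z≤n)) ⟩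
  F (summary 1 2 (suc (suc p))) + F (summary 2 (3 + p) (suc p))
    ≡⟨ cong₂ _+_ (transfer-power-ones k r (suc p)) (transfer-power-gap k r 2 p 0 (suc p) (3 + p) ≤-refl (sym (+-identityʳ (3 + p)))) ⟩
  plateauWalks k r (suc p) + (if suc p ≡ᵇ k then walks r p 0 else 0) ∎
  where
  open ≡-Reasoning
  F : Summary → ℕ
  F = transfer-power (3 + p) r (plateau-indicator k)

d≡plateauWalks : ∀ r k → d (suc (suc r)) k ≡ plateauWalks k r 0
d≡plateauWalks r k = trans (d≡transfer-power r k) (transfer-power-ones k r 0)

plateauWalks-few : ∀ k r p → k ≤ p → plateauWalks k r p ≡ 0
plateauWalks-few k zero p k≤p rewrite ≡ᵇ-false (>⇒≢ (s≤s k≤p)) = refl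
plateauWalks-few k (suc r) p k≤p rewrite ≡ᵇ-false (>⇒≢ (s≤s k≤p)) | plateauWalks-few k r (suc p) (m≤n⇒m≤1+n k≤p) = refl

plateauWalks-many : ∀ k r p → suc p + r < k → plateauWalks k r p ≡ 0
plateauWalks-many k zero p p+1<k rewrite ≡ᵇ-false (<⇒≢ (subst (_< k) (+-identityʳ (suc p)) p+1<k)) = refl
plateauWalks-many k (suc r) p p+r+2<k
  rewrite ≡ᵇ-false (<⇒≢ (≤-<-trans (m≤m+n (suc p) (suc r)) p+r+2<k))
        | plateauWalks-many k r (suc p) (subst (_< k) (+-suc (suc p) r) p+r+2<k) = refl

plateauWalks-all : ∀ r p → plateauWalks (suc p + r) r p ≡ 1
plateauWalks-all zero p rewrite +-identityʳ p | ≡ᵇ-refl p = refl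
plateauWalks-all (suc r) p
  rewrite +-suc p r | ≡ᵇ-false (m≢1+m+n p {r}) | plateauWalks-all r (suc p) = refl

plateauWalks-walks : ∀ t L p → plateauWalks (suc p + t) (suc (t + L)) p ≡ walks L (p + t) 0
plateauWalks-walks zero L p
  rewrite +-identityʳ (suc p) | +-identityʳ p | ≡ᵇ-refl (suc p) | plateauWalks-few (suc p) L (suc p) ≤-refl = refl
plateauWalks-walks (suc t) L p
  rewrite ≡ᵇ-false (<⇒≢ (m<m+n (suc p) {suc t} z<s)) | +-suc (suc p) t | +-suc p t | plateauWalks-walks t L (suc p) = +-identityʳ _

walks⁻ : ℕ → ℕ → ℕ → ℕ
walks⁻ L zero e = 0
walks⁻ L (suc d) e = walks L d e

-- The walks from gap d + 1 that step to last + 1 until the gap is 1; by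
-- walks-split the others are as many as the walks from gap d.
descents : ℕ → ℕ → ℕ → ℕ
descents zero zero e = 1
descents zero (suc d) e = 0
descents (suc L) zero e = walks L e 0
descents (suc L) (suc d) e = descents L d (suc e)

walks-split : ∀ L d e → walks L d e ≡ walks⁻ L d e + descents L d e
walks-split zero zero e = refl
walks-split zero (suc d) e = refl
walks-split (suc L) zero e = refl
walks-split (suc L) (suc zero) e rewrite walks-split L zero (suc e) = +-comm (descents L zero (suc e)) (walks L e 0)
walks-split (suc L) (suc (suc d)) e rewrite walks-split L (suc d) (suc e) =
  xy∙z≈xz∙y (walks L d (suc e)) (descents L (suc d) (suc e)) (walks L e 0)

descents-short : ∀ L d e → L < d → descents L d e ≡ 0
descents-short zero (suc d) e _ = refl
descents-short (suc L) (suc d) e (s≤s L<d) = descents-short L d (suc e) L<d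

descents-exact : ∀ d e → descents d d e ≡ 1
descents-exact zero e = refl
descents-exact (suc d) e = descents-exact d (suc e)

descents-long : ∀ d L e → descents (suc (d + L)) d e ≡ walks L (d + e) 0
descents-long zero L e = refl
descents-long (suc d) L e = trans (descents-long d L (suc e)) (cong (λ t → walks L t 0) (+-suc d e))

d-diagonal : ∀ r → d (suc r) r ≡ 1
d-diagonal zero = refl
d-diagonal (suc r) = trans (d≡plateauWalks r (suc r)) (plateauWalks-all r 0)

d-walks⁻ : ∀ k L → d (suc (suc (k + L))) k ≡ walks⁻ L k 0
d-walks⁻ zero L = trans (d≡plateauWalks L 0) (plateauWalks-few 0 L 0 z≤n)
d-walks⁻ (suc k) L = trans (d≡plateauWalks (suc (k + L)) (suc k)) (plateauWalks-walks k L 0)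

d-descents : ∀ k L → d (suc (suc L)) (suc k) ≡ descents L k 0
d-descents k L with <-cmp L k
... | tri< L<k _ _ = trans (d≡plateauWalks L (suc k)) (trans (plateauWalks-many (suc k) L 0 (s≤s L<k)) (sym (descents-short L k 0 L<k)))
... | tri≈ _ refl _ = trans (d≡plateauWalks L (suc L)) (trans (plateauWalks-all L 0) (sym (descents-exact L 0)))
... | tri> _ _ k<L with m≤n⇒∃[o]m+o≡n k<L
...   | L′ , refl = begin
  d (3 + (k + L′)) (suc k)       ≡⟨ d≡plateauWalks (suc (k + L′)) (suc k) ⟩
  plateauWalks (suc k) (suc (k + L′)) 0 ≡⟨ plateauWalks-walks k L′ 0 ⟩
  walks L′ k 0                    ≡⟨ cong (λ t → walks L′ t 0) (+-identityʳ k) ⟨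
  walks L′ (k + 0) 0              ≡⟨ descents-long k L′ 0 ⟨
  descents (suc (k + L′)) k 0     ∎
  where open ≡-Reasoning

d-recurrence : ∀ r k → k ≤ r → d (suc (suc r)) (suc k) ≡ d (suc r) k + d (suc r ∸ k) (suc k)
d-recurrence r k k≤r with m≤n⇒m<n∨m≡n k≤r
... | inj₂ refl = begin
  d (2 + r) (suc r)                 ≡⟨ d-diagonal (suc r) ⟩
  1                                 ≡⟨ cong₂ _+_ (d-diagonal r) (cong (λ n → d n (suc r)) (m+n∸n≡m 1 r)) ⟨
  d (suc r) r + d (suc r ∸ r) (suc r) ∎
  where open ≡-Reasoning
... | inj₁ k<r with m≤n⇒∃[o]m+o≡n k<r
...   | L , refl = begin
  d (3 + (k + L)) (suc k)                   ≡⟨ d≡plateauWalks (suc (k + L)) (suc k) ⟩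
  plateauWalks (suc k) (suc (k + L)) 0      ≡⟨ plateauWalks-walks k L 0 ⟩
  walks L k 0                               ≡⟨ walks-split L k 0 ⟩
  walks⁻ L k 0 + descents L k 0             ≡⟨ cong₂ _+_ (d-walks⁻ k L) (trans (cong (λ n → d n (suc k)) (remaining k)) (d-descents k L)) ⟨
  d (2 + (k + L)) k + d (2 + (k + L) ∸ k) (suc k) ∎
  where
  open ≡-Reasoning
  remaining : ∀ k → 2 + (k + L) ∸ k ≡ 2 + L
  remaining zero = refl
  remaining (suc k) = remaining k

proposition5p4 : (d 1 1 ≡ 0)
    × (∀ (n k : ℕ) → 2 ≤ n → 1 ≤ k → k ≤ n ∸ 1 →
        d n k ≡ d (n ∸ 1) (k ∸ 1) + d (n ∸ k) k)
proposition5p4 = refl , λ { (suc (suc r)) (suc k) _ _ (s≤s k≤r) → d-recurrence r k k≤r }
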